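{- The existential closure of every E-flat formula is equivalent to a sentence of the form $$\exists \underline z\;\exists \underline y.\;\alpha(\underline y,\underline z)\wedge \sharp\{x\mid \beta_1(x,\mathbf a(x),\underline y,\underline z)\}=z_1\wedge\cdots\wedge \sharp\{x\mid \beta_K(x,\mathbf a(x),\underline y,\underline z)\}=z_K,$$ where $\underline y$ and $\underline z=z_1,\dots,z_K$ are tuples of variables, $\alpha$ is an arithmetic formula, and $\beta_1,\dots,\beta_K$ are basic formulae (in which the only array terms are of the form $a(x)$ for array-ids $a$ in the tuple $\mathbf a$) that form a partition.
   Context: Logic: Presburger arithmetic over $\mathbb Z$ extended with free unary function symbols (array-ids) and cardinality terms. Terms: numerals $n\in\mathbb Z$, parameters (free constants, including a distinguished parameter $N$), individual variables, $t+t$, $-t$, $a(t)$ for an array-id $a$, and $\sharp\{x\mid\phi\}$. Atoms: $t<t$, $t=t$, $t\equiv_n t$. Formulae are built from atoms by $\wedge,\neg,\exists x$. Semantics: the intended interpretation is the integers; each array-id $a$ is interpreted as a function $\mathbb Z\to\mathbb Z$ with $a(x)=0$ for $x\notin[0,N)=\{n\in\mathbb Z: 0\le n<N\}$; $\sharp\{x\mid\phi\}$ denotes the cardinality of the finite set of $x\in[0,N)$ such that $\phi(x)$ holds (it binds $x$). Substitutions are always capture-avoiding. Satisfiability means some assignment to parameters, free variables and array-ids (respecting these conventions) makes the formula true; two formulae are equivalent if they have the same truth value under every such assignment. An arithmetic formula is one containing neither array-ids nor $\sharp$. A basic formula is one obtained from an arithmetic formula by simultaneously replacing some free variables by terms $a(y)$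 with $y$ a variable and $a$ an array-id. An E-flat formula is a formula of the form $\exists\underline z.\,\alpha\wedge\sharp\{x\mid\beta_1\}=z_1\wedge\cdots\wedge\sharp\{x\mid\beta_K\}=z_K$ with $\underline z=z_1,\dots,z_K$, where $\alpha,\beta_1,\dots,\beta_K$ are basic formulae and $x$ does not occur in $\alpha$ ($\alpha$ and the $\beta_j$ may contain further free variables and terms $a(y)$, $a(z_j)$; the $\beta_j$ may contain $x$ and $a(x)$). Formulae $\varphi_1,\dots,\varphi_K$ form a partition if $\bigvee_{l}\varphi_l$ and $\neg(\varphi_l\wedge\varphi_h)$ for all $h\ne l$ are valid. The existential closure of a formula is obtained by existentially quantifying all its free variables. -}

module Defs where

open import Data.Nat as ℕ using (ℕ; zero; suc; _∸_; _⊔_)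
open import Data.Integer as ℤ using (ℤ; +_; -[1+_])
open import Data.Integer.Divisibility using (_∣_)
open import Data.Bool using (Bool; true; false; if_then_else_; T)
open import Data.Fin using (Fin; toℕ)
import Data.Fin as Fin
open import Data.Product using (Σ; _×_; _,_)
open import Data.Sum using (_⊎_)
open import Relation.Binary.PropositionalEquality using (_≡_; _≢_)
open import Relation.Nullary using (¬_)
open import Function.Bundles using (_⇔_)

-- Syntax (de Bruijn indices for individual variables)
--   num n      : numeral n ∈ ℤ
--   par i      : the i-th parameter (free constant)
--   Npar       : the distinguished parameter N
--   var i      : individual variable (de Bruijn index)
--   app a t    : a(t), a an array-id (array-ids are indexed by ℕ)
--   card φ     : ♯{x | φ}, binding index 0 in φ

mutual
  data Term : Set where
    num  : ℤ → Term
    par  : ℕ → Term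
    Npar : Term
    var  : ℕ → Term
    _⊕_  : Term → Term → Term
    neg  : Term → Term
    app  : ℕ → Term → Term
    card : Form → Term

  data Form : Set where
    lt   : Term → Term → Form
    eq   : Term → Term → Form
    cng  : ℕ → Term → Term → Form
    _∧'_ : Form → Form → Form
    not  : Form → Form
    ex   : Form → Form

tt' : Form
tt' = eq (num (+ 0)) (num (+ 0))

ff' : Form
ff' = not tt'

_∨'_ : Form → Form → Form
φ ∨' ψ = not (not φ ∧' not ψ)

⋀ : (K : ℕ) → (Fin K → Form) → Form
⋀ zero    f = tt'
⋀ (suc K) f = f Fin.zero ∧' ⋀ K (λ j → f (Fin.suc j))

⋁ : (K : ℕ) → (Fin K → Form) → Form
⋁ zero    f = ff'
⋁ (suc K) f = f Fin.zero ∨' ⋁ K (λ j → f (Fin.suc j))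

exN : ℕ → Form → Form
exN zero    φ = φ
exN (suc k) φ = ex (exN k φ)

-- Free variables: fvb φ = 1 + largest free de Bruijn index (0 if none)

mutual
  fvbT : Term → ℕ
  fvbT (num _)  = 0
  fvbT (par _)  = 0
  fvbT Npar     = 0
  fvbT (var i)  = suc i
  fvbT (t ⊕ s)  = fvbT t ⊔ fvbT s
  fvbT (neg t)  = fvbT t
  fvbT (app _ t) = fvbT t
  fvbT (card φ) = fvb φ ∸ 1

  fvb : Form → ℕ
  fvb (lt t s)    = fvbT t ⊔ fvbT s
  fvb (eq t s)    = fvbT t ⊔ fvbT s
  fvb (cng _ t s) = fvbT t ⊔ fvbT s
  fvb (φ ∧' ψ)    = fvb φ ⊔ fvb ψ
  fvb (not φ)     = fvb φ
  fvb (ex φ)      = fvb φ ∸ 1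

closure : Form → Form
closure φ = exN (fvb φ) φ

ext : (ℕ → ℕ) → ℕ → ℕ
ext r zero    = zero
ext r (suc i) = suc (r i)

mutual
  renT : (ℕ → ℕ) → Term → Term
  renT r (num n)   = num n
  renT r (par i)   = par i
  renT r Npar      = Npar
  renT r (var i)   = var (r i)
  renT r (t ⊕ s)   = renT r t ⊕ renT r s
  renT r (neg t)   = neg (renT r t)
  renT r (app a t) = app a (renT r t)
  renT r (card φ)  = card (renF (ext r) φ)

  renF : (ℕ → ℕ) → Form → Form
  renF r (lt t s)    = lt (renT r t) (renT r s)
  renF r (eq t s)    = eq (renT r t) (renT r s)
  renF r (cng n t s) = cng n (renT r t) (renT r s)
  renF r (φ ∧' ψ)    = renF r φ ∧' renF r ψ
  renF r (not φ)     = not (renF r φ)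
  renF r (ex φ)      = ex (renF (ext r) φ)

exts : (ℕ → Term) → ℕ → Term
exts σ zero    = var zero
exts σ (suc i) = renT suc (σ i)

mutual
  subT : (ℕ → Term) → Term → Term
  subT σ (num n)   = num n
  subT σ (par i)   = par i
  subT σ Npar      = Npar
  subT σ (var i)   = σ i
  subT σ (t ⊕ s)   = subT σ t ⊕ subT σ s
  subT σ (neg t)   = neg (subT σ t)
  subT σ (app a t) = app a (subT σ t)
  subT σ (card φ)  = card (subF (exts σ) φ)

  subF : (ℕ → Term) → Form → Form
  subF σ (lt t s)    = lt (subT σ t) (subT σ s)
  subF σ (eq t s)    = eq (subT σ t) (subT σ s)
  subF σ (cng n t s) = cng n (subT σ t) (subT σ s)
  subF σ (φ ∧' ψ)    = subF σ φ ∧' subF σ ψ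
  subF σ (not φ)     = not (subF σ φ)
  subF σ (ex φ)      = ex (subF (exts σ) φ)

mutual
  ArithT : Term → Set
  ArithT (num _)   = ⊤'
  ArithT (par _)   = ⊤'
  ArithT Npar      = ⊤'
  ArithT (var _)   = ⊤'
  ArithT (t ⊕ s)   = ArithT t × ArithT s
  ArithT (neg t)   = ArithT t
  ArithT (app _ _) = ⊥'
  ArithT (card _)  = ⊥'

  Arith : Form → Set
  Arith (lt t s)    = ArithT t × ArithT s
  Arith (eq t s)    = ArithT t × ArithT s
  Arith (cng _ t s) = ArithT t × ArithT s
  Arith (φ ∧' ψ)    = Arith φ × Arith ψ
  Arith (not φ)     = Arith φ
  Arith (ex φ)      = Arith φ

  data ⊤' : Set where
    tt : ⊤'

  data ⊥' : Set where

Basic : Form → Set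
Basic φ = Σ Form λ ψ → Arith ψ × Σ (ℕ → Term) λ σ →
            ((i : ℕ) → (σ i ≡ var i) ⊎ Σ ℕ λ a → Σ ℕ λ y → σ i ≡ app a (var y))
            × φ ≡ subF σ ψ

-- basic formula whose only array terms are of the form a(x),
-- x being the variable bound by the cardinality operator (index 0)
BasicX : Form → Set
BasicX φ = Σ Form λ ψ → Arith ψ × Σ (ℕ → Term) λ σ →
            ((i : ℕ) → (σ i ≡ var i) ⊎ Σ ℕ λ a → σ i ≡ app a (var 0))
            × φ ≡ subF σ ψ

clamp : ℤ → ℕ                      -- |[0,N)| as a natural number
clamp (+ n)    = n
clamp -[1+ n ] = 0

record Str : Set where
  field
    N      : ℤ
    params : ℕ → ℤ
    arr    : ℕ → ℤ → ℤ
    arr-out : (a : ℕ) (u : ℤ) → (u ℤ.< + 0 ⊎ N ℤ.≤ u) → arr a u ≡ + 0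

Env : Set
Env = ℕ → ℤ

_∷ᵉ_ : ℤ → Env → Env
(d ∷ᵉ ρ) zero    = d
(d ∷ᵉ ρ) (suc i) = ρ i

countBelow : (ℕ → Bool) → ℕ → ℕ
countBelow P zero    = 0
countBelow P (suc n) = countBelow P n ℕ.+ (if P n then 1 else 0)

mutual
  Eval : Str → Env → Term → ℤ → Set
  Eval M ρ (num n)   v = v ≡ n
  Eval M ρ (par i)   v = v ≡ Str.params M i
  Eval M ρ Npar      v = v ≡ Str.N M
  Eval M ρ (var i)   v = v ≡ ρ i
  Eval M ρ (t ⊕ s)   v = Σ ℤ λ u → Σ ℤ λ w → Eval M ρ t u × Eval M ρ s w × v ≡ u ℤ.+ w
  Eval M ρ (neg t)   v = Σ ℤ λ u → Eval M ρ t u × v ≡ ℤ.- u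
  Eval M ρ (app a t) v = Σ ℤ λ u → Eval M ρ t u × v ≡ Str.arr M a u
  Eval M ρ (card φ)  v = Σ (ℕ → Bool) λ P →
      ((i : ℕ) → + i ℤ.< Str.N M → (T (P i) ⇔ Sat M ((+ i) ∷ᵉ ρ) φ))
      × v ≡ + countBelow P (clamp (Str.N M))

  Sat : Str → Env → Form → Set
  Sat M ρ (lt t s)    = Σ ℤ λ u → Σ ℤ λ w → Eval M ρ t u × Eval M ρ s w × u ℤ.< w
  Sat M ρ (eq t s)    = Σ ℤ λ u → Σ ℤ λ w → Eval M ρ t u × Eval M ρ s w × u ≡ w
  Sat M ρ (cng n t s) = Σ ℤ λ u → Σ ℤ λ w → Eval M ρ t u × Eval M ρ s w × (+ n) ∣ (u ℤ.- w)
  Sat M ρ (φ ∧' ψ)    = Sat M ρ φ × Sat M ρ ψ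
  Sat M ρ (not φ)     = ¬ Sat M ρ φ
  Sat M ρ (ex φ)      = Σ ℤ λ d → Sat M (d ∷ᵉ ρ) φ

Valid : Form → Set
Valid φ = (M : Str) (ρ : Env) → Sat M ρ φ

Equiv : Form → Form → Set
Equiv φ ψ = (M : Str) (ρ : Env) → Sat M ρ φ ⇔ Sat M ρ ψ

Partition : (K : ℕ) → (Fin K → Form) → Set
Partition K β = Valid (⋁ K β) × ((l h : Fin K) → l ≢ h → Valid (not (β l ∧' β h)))

-- E-flat formulae:  ∃ z₁…z_K. α ∧ ⋀_j ♯{x | β_j} = z_j
-- (z_j is de Bruijn index toℕ j inside the block; x is index 0 of β_j,
--  so x cannot occur in α)

flatBody : (K : ℕ) → ℕ → Form → (Fin K → Form) → Form
flatBody K m α β = α ∧' ⋀ K (λ j → eq (card (β j)) (var (m ℕ.+ toℕ j)))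

EFlat : Form → Set
EFlat φ = Σ ℕ λ K → Σ Form λ α → Σ (Fin K → Form) λ β →
            Basic α × ((j : Fin K) → Basic (β j)) × φ ≡ exN K (flatBody K 0 α β)

PartitionForm : Form → Set
PartitionForm θ = Σ ℕ λ K → Σ ℕ λ m → Σ Form λ α → Σ (Fin K → Form) λ β →
    Arith α × ((j : Fin K) → BasicX (β j)) × Partition K β
    × θ ≡ exN K (exN m (flatBody K m α β))
    × fvb θ ≡ 0

-- Each array read a(y) with y a variable other than the counted x is replaced by a fresh
-- variable s, pinned down arithmetically by  ♯{x | x = y ∧ a(x) ≠ s} = 0  together with
-- "0 ≤ y < N or s = 0" (arrays vanish outside [0,N)).  All cardinality conditions, the
-- original β_j and these new checks, then speak only about x, the a(x) and variables.
-- The 2^L cells of the Boolean algebra generated by these L formulae partition [0,N),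
-- and every original count is the sum of the sizes of the cells inside its formula, a
-- linear condition on fresh cell-size variables.  Excluded middle decides membership.

module Submission where

open import Defs
open import Level using (0ℓ)
open import Axiom.ExcludedMiddle using (ExcludedMiddle)
open import Data.Bool using (Bool; true; false; if_then_else_; T; _∧_) renaming (not to bnot)
import Data.Bool.Properties as BoolP
open import Data.Empty using (⊥; ⊥-elim)
open import Data.Fin as Fin using (Fin; toℕ; fromℕ<; _↑ˡ_; _↑ʳ_; splitAt)
import Data.Fin.Properties as FinP
open import Data.Integer as ℤ using (ℤ; +_)
import Data.Integer.Properties as ℤP
open import Data.Nat as ℕ using (ℕ; zero; suc; _+_; _*_; _∸_; _⊔_; _<_; _≤_; z≤n; s≤s; _<?_; _/_; _%_)
import Data.Nat.Properties as ℕP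
import Data.Nat.DivMod as DivMod
open import Data.Nat.Divisibility using (divides-refl)
open import Algebra.Properties.CommutativeSemigroup ℕP.+-commutativeSemigroup
  using () renaming (interchange to +-interchange)
open import Data.Product using (Σ; _×_; _,_; proj₁; proj₂)
open import Data.Product.Function.NonDependent.Propositional using (_×-⇔_)
open import Data.Sum using (_⊎_; inj₁; inj₂; [_,_]′)
open import Data.Unit using (tt)
open import Function.Bundles using (_⇔_; mk⇔; Equivalence)
import Function.Properties.Equivalence as ⇔
open import Function.Related.TypeIsomorphisms using (¬-cong-⇔)
open import Function.Base using (_∘_)
open import Relation.Binary.PropositionalEquality
  using (_≡_; _≢_; _≗_; refl; sym; trans; cong; cong₂; subst; module ≡-Reasoning)
open import Relation.Nullary using (¬_; yes; no)
open import Relation.Nullary.Decidable using (isYes)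

open Equivalence using (to; from)

-- Environments and existential blocks

∷ᵉ-cong : ∀ {ρ ρ'} d → ρ ≗ ρ' → (d ∷ᵉ ρ) ≗ (d ∷ᵉ ρ')
∷ᵉ-cong d e zero    = refl
∷ᵉ-cong d e (suc i) = e i

mutual
  Eval-≗ : ∀ M {ρ ρ'} → ρ ≗ ρ' → ∀ t {v} → Eval M ρ t v → Eval M ρ' t v
  Eval-≗ M e (num _)   ev = ev
  Eval-≗ M e (par _)   ev = ev
  Eval-≗ M e Npar      ev = ev
  Eval-≗ M e (var i)   ev = trans ev (e i)
  Eval-≗ M e (t ⊕ s)   (u , w , et , es , q) = u , w , Eval-≗ M e t et , Eval-≗ M e s es , q
  Eval-≗ M e (neg t)   (u , et , q) = u , Eval-≗ M e t et , q
  Eval-≗ M e (app a t) (u , et , q) = u , Eval-≗ M e t et , q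
  Eval-≗ M e (card φ)  (P , hP , q) =
    P , (λ i i<N → mk⇔ (λ p → Sat-≗ M (∷ᵉ-cong (+ i) e) φ (to (hP i i<N) p))
                       (λ s → from (hP i i<N) (Sat-≗ M (∷ᵉ-cong (+ i) (λ k → sym (e k))) φ s))) , q

  Sat-≗ : ∀ M {ρ ρ'} → ρ ≗ ρ' → ∀ φ → Sat M ρ φ → Sat M ρ' φ
  Sat-≗ M e (lt t s)    (u , w , et , es , q) = u , w , Eval-≗ M e t et , Eval-≗ M e s es , q
  Sat-≗ M e (eq t s)    (u , w , et , es , q) = u , w , Eval-≗ M e t et , Eval-≗ M e s es , q
  Sat-≗ M e (cng n t s) (u , w , et , es , q) = u , w , Eval-≗ M e t et , Eval-≗ M e s es , q
  Sat-≗ M e (φ ∧' ψ)    (sφ , sψ) = Sat-≗ M e φ sφ , Sat-≗ M e ψ sψ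
  Sat-≗ M e (not φ)     ¬s s = ¬s (Sat-≗ M (λ i → sym (e i)) φ s)
  Sat-≗ M e (ex φ)      (d , s) = d , Sat-≗ M (∷ᵉ-cong d e) φ s

Sat-cong : ∀ M {ρ ρ'} → ρ ≗ ρ' → ∀ φ → Sat M ρ φ ⇔ Sat M ρ' φ
Sat-cong M e φ = mk⇔ (Sat-≗ M e φ) (Sat-≗ M (λ i → sym (e i)) φ)

prepend : ℕ → (ℕ → ℤ) → Env → Env
prepend k e ρ i with i <? k
... | yes _ = e i
... | no _  = ρ (i ∸ k)

prepend-< : ∀ k e ρ {i} → i < k → prepend k e ρ i ≡ e i
prepend-< k e ρ {i} i<k with i <? k
... | yes _  = refl
... | no i≮k = ⊥-elim (i≮k i<k)

prepend-≮ : ∀ k e ρ {i} → ¬ i < k → prepend k e ρ i ≡ ρ (i ∸ k)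
prepend-≮ k e ρ {i} i≮k with i <? k
... | yes i<k = ⊥-elim (i≮k i<k)
... | no _    = refl

prepend-suc : ∀ k e ρ → prepend (suc k) e ρ ≗ prepend k e (e k ∷ᵉ ρ)
prepend-suc k e ρ i with i <? suc k | i <? k
... | yes _    | yes _  = refl
... | yes i<1+k | no i≮k with ℕP.≤-antisym (ℕP.≤-pred i<1+k) (ℕP.≮⇒≥ i≮k)
...   | refl rewrite ℕP.n∸n≡0 i = refl
prepend-suc k e ρ i | no i≮1+k | yes i<k = ⊥-elim (i≮1+k (ℕP.m<n⇒m<1+n i<k))
prepend-suc k e ρ i | no i≮1+k | no _ with i | ℕP.≮⇒≥ i≮1+k
... | suc i' | s≤s k≤i' rewrite ℕP.+-∸-assoc 1 k≤i' = refl

prepend-agree : ∀ k {e e'} ρ → (∀ {i} → i < k → e i ≡ e' i) → prepend k e ρ ≗ prepend k e' ρ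
prepend-agree k ρ agree i with i <? k
... | yes i<k = agree i<k
... | no _    = refl

exN-+ : ∀ a b φ → exN (a + b) φ ≡ exN a (exN b φ)
exN-+ zero    b φ = refl
exN-+ (suc a) b φ = cong ex (exN-+ a b φ)

Sat-exN : ∀ M ρ k φ → Sat M ρ (exN k φ) ⇔ Σ (ℕ → ℤ) λ e → Sat M (prepend k e ρ) φ
Sat-exN M ρ k φ = mk⇔ (elim ρ k) (λ (e , s) → intro ρ k e s)
  where
  intro : ∀ ρ k e → Sat M (prepend k e ρ) φ → Sat M ρ (exN k φ)
  intro ρ zero    e s = s
  intro ρ (suc k) e s = e k , intro (e k ∷ᵉ ρ) k e (Sat-≗ M (prepend-suc k e ρ) φ s)

  elim : ∀ ρ k → Sat M ρ (exN k φ) → Σ (ℕ → ℤ) λ e → Sat M (prepend k e ρ) φ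
  elim ρ zero    s = (λ _ → + 0) , s
  elim ρ (suc k) (d , s) with elim (d ∷ᵉ ρ) k s
  ... | e , s' = e' , Sat-≗ M (λ i → sym (shift i)) φ s'
    where
    e' : ℕ → ℤ
    e' = prepend k e (λ _ → d)
    shift : prepend (suc k) e' ρ ≗ prepend k e (d ∷ᵉ ρ)
    shift i = trans (prepend-suc k e' ρ i)
      (trans (cong (λ z → prepend k e' (z ∷ᵉ ρ) i) (prepend-≮ k e _ (ℕP.<-irrefl refl)))
             (prepend-agree k (d ∷ᵉ ρ) (λ i<k → prepend-< k e _ i<k) i))

-- Substituting variables and array reads

mutual
  OccursT : ℕ → Term → Set
  OccursT k (var i)   = k ≡ i
  OccursT k (t ⊕ s)   = OccursT k t ⊎ OccursT k s
  OccursT k (neg t)   = OccursT k t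
  OccursT k (app _ t) = OccursT k t
  OccursT k (num _)   = ⊥
  OccursT k (par _)   = ⊥
  OccursT k Npar      = ⊥
  OccursT k (card _)  = ⊥

  Occurs : ℕ → Form → Set
  Occurs k (lt t s)    = OccursT k t ⊎ OccursT k s
  Occurs k (eq t s)    = OccursT k t ⊎ OccursT k s
  Occurs k (cng _ t s) = OccursT k t ⊎ OccursT k s
  Occurs k (φ ∧' ψ)    = Occurs k φ ⊎ Occurs k ψ
  Occurs k (not φ)     = Occurs k φ
  Occurs k (ex φ)      = Occurs (suc k) φ

VarOrRead : Term → Set
VarOrRead t = (Σ ℕ λ y → t ≡ var y) ⊎ (Σ ℕ λ a → Σ ℕ λ y → t ≡ app a (var y))

ReadSubst : (ℕ → Term) → Set
ReadSubst σ = ∀ i → VarOrRead (σ i)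

exts-ReadSubst : ∀ {σ} → ReadSubst σ → ReadSubst (exts σ)
exts-ReadSubst rs zero = inj₁ (0 , refl)
exts-ReadSubst rs (suc i) with rs i
... | inj₁ (y , e)     rewrite e = inj₁ (suc y , refl)
... | inj₂ (a , y , e) rewrite e = inj₂ (a , suc y , refl)

Eval-weaken : ∀ M ρ d {t v} → VarOrRead t → Eval M ρ t v → Eval M (d ∷ᵉ ρ) (renT suc t) v
Eval-weaken M ρ d (inj₁ (y , refl))     ev = ev
Eval-weaken M ρ d (inj₂ (a , y , refl)) ev = ev

Eval-VarOrRead-unique : ∀ M ρ {t v w} → VarOrRead t → Eval M ρ t v → Eval M ρ t w → v ≡ w
Eval-VarOrRead-unique M ρ (inj₁ (y , refl)) ev ew = trans ev (sym ew)
Eval-VarOrRead-unique M ρ (inj₂ (a , y , refl)) (u , eu , qv) (u' , eu' , qw) =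
  trans qv (trans (cong (Str.arr M a) (trans eu (sym eu'))) (sym qw))

binary-⇔ : ∀ {E₁ E₂ F₁ F₂ : ℤ → Set} {R : ℤ → ℤ → Set} →
  (∀ u → E₁ u ⇔ E₂ u) → (∀ w → F₁ w ⇔ F₂ w) →
  (Σ ℤ λ u → Σ ℤ λ w → E₁ u × F₁ w × R u w)
  ⇔ (Σ ℤ λ u → Σ ℤ λ w → E₂ u × F₂ w × R u w)
binary-⇔ e f = mk⇔ (λ (u , w , eu , fw , r) → u , w , to (e u) eu , to (f w) fw , r)
                   (λ (u , w , eu , fw , r) → u , w , from (e u) eu , from (f w) fw , r)

module _ (M : Str) where
  mutual
    Eval-subT : ∀ {ρ ρ' σ} t → ReadSubst σ → (∀ k → OccursT k t → Eval M ρ (σ k) (ρ' k)) → ArithT t →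
                ∀ v → Eval M ρ (subT σ t) v ⇔ Eval M ρ' t v
    Eval-subT (num _) rs R _ v = ⇔.refl
    Eval-subT (par _) rs R _ v = ⇔.refl
    Eval-subT Npar    rs R _ v = ⇔.refl
    Eval-subT {ρ} {ρ'} {σ} (var i) rs R _ v =
      mk⇔ (λ ev → Eval-VarOrRead-unique M ρ (rs i) ev (R i refl))
          (λ v≡ρ'i → subst (Eval M ρ (σ i)) (sym v≡ρ'i) (R i refl))
    Eval-subT (t ⊕ s) rs R (at , as) v = atom-subT t s rs R (at , as)
    Eval-subT (neg t) rs R at v =
      mk⇔ (λ (u , et , q) → u , to (Eval-subT t rs R at u) et , q)
          (λ (u , et , q) → u , from (Eval-subT t rs R at u) et , q)

    atom-subT : ∀ {ρ ρ' σ} t s → ReadSubst σ →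
                (∀ k → OccursT k t ⊎ OccursT k s → Eval M ρ (σ k) (ρ' k)) →
                ArithT t × ArithT s → {R : ℤ → ℤ → Set} →
                (Σ ℤ λ u → Σ ℤ λ w → Eval M ρ (subT σ t) u × Eval M ρ (subT σ s) w × R u w)
                ⇔ (Σ ℤ λ u → Σ ℤ λ w → Eval M ρ' t u × Eval M ρ' s w × R u w)
    atom-subT t s rs R (at , as) =
      binary-⇔ (Eval-subT t rs (λ k o → R k (inj₁ o)) at) (Eval-subT s rs (λ k o → R k (inj₂ o)) as)

  Sat-subF : ∀ {ρ ρ' σ} φ → ReadSubst σ → (∀ k → Occurs k φ → Eval M ρ (σ k) (ρ' k)) → Arith φ →
             Sat M ρ (subF σ φ) ⇔ Sat M ρ' φ
  Sat-subF (lt t s)    rs R a = atom-subT t s rs R a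
  Sat-subF (eq t s)    rs R a = atom-subT t s rs R a
  Sat-subF (cng n t s) rs R a = atom-subT t s rs R a
  Sat-subF (φ ∧' ψ)    rs R (aφ , aψ) =
    Sat-subF φ rs (λ k o → R k (inj₁ o)) aφ ×-⇔ Sat-subF ψ rs (λ k o → R k (inj₂ o)) aψ
  Sat-subF (not φ)     rs R a = ¬-cong-⇔ (Sat-subF φ rs R a)
  Sat-subF {ρ} {ρ'} {σ} (ex φ) rs R a =
    mk⇔ (λ (d , s) → d , to (IH d) s) (λ (d , s) → d , from (IH d) s)
    where
    R' : ∀ d k → Occurs k φ → Eval M (d ∷ᵉ ρ) (exts σ k) ((d ∷ᵉ ρ') k)
    R' d zero    o = refl
    R' d (suc k) o = Eval-weaken M ρ d (rs k) (R k o)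
    IH : ∀ d → Sat M (d ∷ᵉ ρ) (subF (exts σ) φ) ⇔ Sat M (d ∷ᵉ ρ') φ
    IH d = Sat-subF φ (exts-ReadSubst rs) (R' d) a

-- Free-variable bounds

fvbT-renT-suc : ∀ {t} → VarOrRead t → fvbT (renT suc t) ≡ suc (fvbT t)
fvbT-renT-suc (inj₁ (y , refl))     = refl
fvbT-renT-suc (inj₂ (a , y , refl)) = refl

mutual
  OccursT⇒<fvbT : ∀ {k} t → OccursT k t → k < fvbT t
  OccursT⇒<fvbT (var i)   refl     = ℕP.≤-refl
  OccursT⇒<fvbT (t ⊕ s)   (inj₁ o) = ℕP.m≤n⇒m≤n⊔o _ (OccursT⇒<fvbT t o)
  OccursT⇒<fvbT (t ⊕ s)   (inj₂ o) = ℕP.m≤n⇒m≤o⊔n _ (OccursT⇒<fvbT s o)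
  OccursT⇒<fvbT (neg t)   o        = OccursT⇒<fvbT t o
  OccursT⇒<fvbT (app _ t) o        = OccursT⇒<fvbT t o

  Occurs⇒<fvb : ∀ {k} φ → Occurs k φ → k < fvb φ
  Occurs⇒<fvb (lt t s)    o        = occurs-atom⇒< t s o
  Occurs⇒<fvb (eq t s)    o        = occurs-atom⇒< t s o
  Occurs⇒<fvb (cng _ t s) o        = occurs-atom⇒< t s o
  Occurs⇒<fvb (φ ∧' ψ)    (inj₁ o) = ℕP.m≤n⇒m≤n⊔o _ (Occurs⇒<fvb φ o)
  Occurs⇒<fvb (φ ∧' ψ)    (inj₂ o) = ℕP.m≤n⇒m≤o⊔n _ (Occurs⇒<fvb ψ o)
  Occurs⇒<fvb (not φ)     o        = Occurs⇒<fvb φ o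
  Occurs⇒<fvb (ex φ)      o        = ℕP.∸-monoˡ-≤ 1 (Occurs⇒<fvb φ o)

  private
    occurs-atom⇒< : ∀ {k} t s → OccursT k t ⊎ OccursT k s → k < fvbT t ⊔ fvbT s
    occurs-atom⇒< t s (inj₁ o) = ℕP.m≤n⇒m≤n⊔o _ (OccursT⇒<fvbT t o)
    occurs-atom⇒< t s (inj₂ o) = ℕP.m≤n⇒m≤o⊔n _ (OccursT⇒<fvbT s o)

mutual
  fvbT-σ≤fvbT-subT : ∀ σ {k} t → OccursT k t → fvbT (σ k) ≤ fvbT (subT σ t)
  fvbT-σ≤fvbT-subT σ (var i)   refl     = ℕP.≤-refl
  fvbT-σ≤fvbT-subT σ (t ⊕ s)   (inj₁ o) = ℕP.m≤n⇒m≤n⊔o _ (fvbT-σ≤fvbT-subT σ t o)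
  fvbT-σ≤fvbT-subT σ (t ⊕ s)   (inj₂ o) = ℕP.m≤n⇒m≤o⊔n _ (fvbT-σ≤fvbT-subT σ s o)
  fvbT-σ≤fvbT-subT σ (neg t)   o        = fvbT-σ≤fvbT-subT σ t o
  fvbT-σ≤fvbT-subT σ (app _ t) o        = fvbT-σ≤fvbT-subT σ t o

  fvbT-σ≤fvb-subF : ∀ {σ} → ReadSubst σ → ∀ {k} φ → Occurs k φ → fvbT (σ k) ≤ fvb (subF σ φ)
  fvbT-σ≤fvb-subF {σ} rs (lt t s)    o        = occurs-atom⇒fvbT≤ σ t s o
  fvbT-σ≤fvb-subF {σ} rs (eq t s)    o        = occurs-atom⇒fvbT≤ σ t s o
  fvbT-σ≤fvb-subF {σ} rs (cng _ t s) o        = occurs-atom⇒fvbT≤ σ t s o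
  fvbT-σ≤fvb-subF rs (φ ∧' ψ)    (inj₁ o) = ℕP.m≤n⇒m≤n⊔o _ (fvbT-σ≤fvb-subF rs φ o)
  fvbT-σ≤fvb-subF rs (φ ∧' ψ)    (inj₂ o) = ℕP.m≤n⇒m≤o⊔n _ (fvbT-σ≤fvb-subF rs ψ o)
  fvbT-σ≤fvb-subF rs (not φ)     o        = fvbT-σ≤fvb-subF rs φ o
  fvbT-σ≤fvb-subF {σ} rs {k} (ex φ) o
    with fvbT-σ≤fvb-subF (exts-ReadSubst rs) φ o
  ... | bound rewrite fvbT-renT-suc (rs k) = ℕP.∸-monoˡ-≤ 1 bound

  private
    occurs-atom⇒fvbT≤ : ∀ σ {k} t s → OccursT k t ⊎ OccursT k s →
                        fvbT (σ k) ≤ fvbT (subT σ t) ⊔ fvbT (subT σ s)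
    occurs-atom⇒fvbT≤ σ t s (inj₁ o) = ℕP.m≤n⇒m≤n⊔o _ (fvbT-σ≤fvbT-subT σ t o)
    occurs-atom⇒fvbT≤ σ t s (inj₂ o) = ℕP.m≤n⇒m≤o⊔n _ (fvbT-σ≤fvbT-subT σ s o)

mutual
  fvbT-subT≤ : ∀ {σ B} → (∀ k → fvbT (σ k) ≤ B) → ∀ t → ArithT t → fvbT (subT σ t) ≤ B
  fvbT-subT≤ bound (num _) _         = z≤n
  fvbT-subT≤ bound (par _) _         = z≤n
  fvbT-subT≤ bound Npar    _         = z≤n
  fvbT-subT≤ bound (var i) _         = bound i
  fvbT-subT≤ bound (t ⊕ s) (at , as) = ℕP.⊔-lub (fvbT-subT≤ bound t at) (fvbT-subT≤ bound s as)
  fvbT-subT≤ bound (neg t) at        = fvbT-subT≤ bound t at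

  fvb-subF≤ : ∀ {σ B} → ReadSubst σ → (∀ k → fvbT (σ k) ≤ B) →
              ∀ φ → Arith φ → fvb (subF σ φ) ≤ B
  fvb-subF≤ rs bound (lt t s)    (at , as) = ℕP.⊔-lub (fvbT-subT≤ bound t at) (fvbT-subT≤ bound s as)
  fvb-subF≤ rs bound (eq t s)    (at , as) = ℕP.⊔-lub (fvbT-subT≤ bound t at) (fvbT-subT≤ bound s as)
  fvb-subF≤ rs bound (cng _ t s) (at , as) = ℕP.⊔-lub (fvbT-subT≤ bound t at) (fvbT-subT≤ bound s as)
  fvb-subF≤ rs bound (φ ∧' ψ)    (aφ , aψ) =
    ℕP.⊔-lub (fvb-subF≤ rs bound φ aφ) (fvb-subF≤ rs bound ψ aψ)
  fvb-subF≤ rs bound (not φ)     aφ        = fvb-subF≤ rs bound φ aφ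
  fvb-subF≤ {σ} {B} rs bound (ex φ) aφ =
    ℕP.∸-monoˡ-≤ 1 (fvb-subF≤ (exts-ReadSubst rs) exts-bound φ aφ)
    where
    exts-bound : ∀ k → fvbT (exts σ k) ≤ suc B
    exts-bound zero = s≤s z≤n
    exts-bound (suc k) rewrite fvbT-renT-suc (rs k) = s≤s (bound k)

fvb-exN : ∀ k φ → fvb (exN k φ) ≡ fvb φ ∸ k
fvb-exN zero    φ = refl
fvb-exN (suc k) φ = trans (cong (_∸ 1) (fvb-exN k φ))
                          (trans (ℕP.∸-+-assoc (fvb φ) k 1) (cong (fvb φ ∸_) (ℕP.+-comm k 1)))

fvb-⋀≤ : ∀ {B} K f → (∀ j → fvb (f j) ≤ B) → fvb (⋀ K f) ≤ B
fvb-⋀≤ zero    f bound = z≤n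
fvb-⋀≤ (suc K) f bound = ℕP.⊔-lub (bound Fin.zero) (fvb-⋀≤ K _ (λ j → bound (Fin.suc j)))

fvb≤fvb-⋀ : ∀ K f j → fvb (f j) ≤ fvb (⋀ K f)
fvb≤fvb-⋀ (suc K) f Fin.zero    = ℕP.m≤m⊔n _ _
fvb≤fvb-⋀ (suc K) f (Fin.suc j) = ℕP.m≤n⇒m≤o⊔n _ (fvb≤fvb-⋀ K _ j)

-- Counting and the cells of a finite family

countBelow-cong : ∀ {P Q : ℕ → Bool} n → (∀ {i} → i < n → P i ≡ Q i) → countBelow P n ≡ countBelow Q n
countBelow-cong zero    P≡Q = refl
countBelow-cong (suc n) P≡Q =
  cong₂ _+_ (countBelow-cong n (λ i<n → P≡Q (ℕP.m<n⇒m<1+n i<n)))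
            (cong (λ b → if b then 1 else 0) (P≡Q ℕP.≤-refl))

countBelow-split : ∀ (P q : ℕ → Bool) n →
  countBelow P n ≡ countBelow (λ x → P x ∧ q x) n + countBelow (λ x → P x ∧ bnot (q x)) n
countBelow-split P q zero    = refl
countBelow-split P q (suc n) =
  trans (cong₂ _+_ (countBelow-split P q n) (bit-split (P n) (q n)))
        (+-interchange (countBelow (λ x → P x ∧ q x) n) _ _ _)
  where
  bit-split : ∀ p r → (if p then 1 else 0) ≡ (if p ∧ r then 1 else 0) + (if p ∧ bnot r then 1 else 0)
  bit-split false r     = refl
  bit-split true  false = refl
  bit-split true  true  = refl

countBelow≡0⇒false : ∀ (P : ℕ → Bool) n → countBelow P n ≡ 0 → ∀ {i} → i < n → P i ≡ false
countBelow≡0⇒false P (suc n) c≡0 {i} i<1+n with P n in Pn≡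
... | true  = ⊥-elim (ℕP.m+1+n≢0 (countBelow P n) c≡0)
... | false with ℕP.m≤n⇒m<n∨m≡n (ℕP.≤-pred i<1+n)
...   | inj₁ i<n  = countBelow≡0⇒false P n (trans (sym (ℕP.+-identityʳ _)) c≡0) i<n
...   | inj₂ refl = Pn≡

countBelow-false : ∀ (P : ℕ → Bool) n → (∀ {i} → i < n → P i ≡ false) → countBelow P n ≡ 0
countBelow-false P zero    P≡false = refl
countBelow-false P (suc n) P≡false rewrite P≡false {n} ℕP.≤-refl =
  trans (ℕP.+-identityʳ _) (countBelow-false P n (λ i<n → P≡false (ℕP.m<n⇒m<1+n i<n)))

pow2 : ℕ → ℕ
pow2 zero    = 1
pow2 (suc L) = pow2 L + pow2 L

withTrue withFalse : ∀ L → Fin (pow2 L) → Fin (pow2 (suc L))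
withTrue  L b = b ↑ˡ pow2 L
withFalse L b = pow2 L ↑ʳ b

module _ {A : Set} (_&_ : A → A → A) (~_ : A → A) (⊤ₐ : A) where

  cellWith : (L : ℕ) → (Fin L → A) → Fin (pow2 L) → A
  cellWith zero    f b = ⊤ₐ
  cellWith (suc L) f b =
    [ (λ b' → f Fin.zero & rest b') , (λ b' → (~ f Fin.zero) & rest b') ]′ (splitAt (pow2 L) b)
    where
    rest : Fin (pow2 L) → A
    rest = cellWith L (λ l → f (Fin.suc l))

  cellWith-withTrue : ∀ L f b →
    cellWith (suc L) f (withTrue L b) ≡ f Fin.zero & cellWith L (λ l → f (Fin.suc l)) b
  cellWith-withTrue L f b rewrite FinP.splitAt-↑ˡ (pow2 L) b (pow2 L) = refl

  cellWith-withFalse : ∀ L f b →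
    cellWith (suc L) f (withFalse L b) ≡ (~ f Fin.zero) & cellWith L (λ l → f (Fin.suc l)) b
  cellWith-withFalse L f b rewrite FinP.splitAt-↑ʳ (pow2 L) (pow2 L) b = refl

cell : (L : ℕ) → (Fin L → Form) → Fin (pow2 L) → Form
cell = cellWith _∧'_ not tt'

cellᵇ : (L : ℕ) → (Fin L → ℕ → Bool) → Fin (pow2 L) → ℕ → Bool
cellᵇ L g b x = cellWith _∧_ bnot true L (λ l → g l x) b

sumCells : (L : ℕ) → (Fin (pow2 L) → ℕ) → ℕ
sumCells zero    f = f Fin.zero
sumCells (suc L) f = sumCells L (λ b → f (withTrue L b)) + sumCells L (λ b → f (withFalse L b))

sumCellsIn : (L : ℕ) → Fin L → (Fin (pow2 L) → ℕ) → ℕ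
sumCellsIn (suc L) Fin.zero    f = sumCells L (λ b → f (withTrue L b))
sumCellsIn (suc L) (Fin.suc l) f =
  sumCellsIn L l (λ b → f (withTrue L b)) + sumCellsIn L l (λ b → f (withFalse L b))

sumCells-cong : ∀ L {f f'} → (∀ b → f b ≡ f' b) → sumCells L f ≡ sumCells L f'
sumCells-cong zero    f≡f' = f≡f' Fin.zero
sumCells-cong (suc L) f≡f' =
  cong₂ _+_ (sumCells-cong L (λ b → f≡f' (withTrue L b))) (sumCells-cong L (λ b → f≡f' (withFalse L b)))

sumCellsIn-cong : ∀ L l {f f'} → (∀ b → f b ≡ f' b) → sumCellsIn L l f ≡ sumCellsIn L l f'
sumCellsIn-cong (suc L) Fin.zero    f≡f' = sumCells-cong L (λ b → f≡f' (withTrue L b))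
sumCellsIn-cong (suc L) (Fin.suc l) f≡f' =
  cong₂ _+_ (sumCellsIn-cong L l (λ b → f≡f' (withTrue L b)))
            (sumCellsIn-cong L l (λ b → f≡f' (withFalse L b)))

module _ (n : ℕ) where
  private
    count : (ℕ → Bool) → ℕ
    count P = countBelow P n

    count-withTrue : ∀ L (g : Fin (suc L) → ℕ → Bool) (h : ℕ → Bool) b →
      count (λ x → h x ∧ cellᵇ (suc L) g (withTrue L b) x)
      ≡ count (λ x → (h x ∧ g Fin.zero x) ∧ cellᵇ L (g ∘ Fin.suc) b x)
    count-withTrue L g h b = countBelow-cong n λ {x} _ →
      trans (cong (h x ∧_) (cellWith-withTrue _∧_ bnot true L (λ l → g l x) b))
            (sym (BoolP.∧-assoc (h x) _ _))

    count-withFalse : ∀ L (g : Fin (suc L) → ℕ → Bool) (h : ℕ → Bool) b →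
      count (λ x → h x ∧ cellᵇ (suc L) g (withFalse L b) x)
      ≡ count (λ x → (h x ∧ bnot (g Fin.zero x)) ∧ cellᵇ L (g ∘ Fin.suc) b x)
    count-withFalse L g h b = countBelow-cong n λ {x} _ →
      trans (cong (h x ∧_) (cellWith-withFalse _∧_ bnot true L (λ l → g l x) b))
            (sym (BoolP.∧-assoc (h x) _ _))

  sumCells-count : ∀ L (g : Fin L → ℕ → Bool) (h : ℕ → Bool) →
    sumCells L (λ b → count (λ x → h x ∧ cellᵇ L g b x)) ≡ count h
  sumCells-count zero    g h = countBelow-cong n (λ {x} _ → BoolP.∧-identityʳ (h x))
  sumCells-count (suc L) g h = begin
    sumCells L (λ b → count (λ x → h x ∧ cellᵇ (suc L) g (withTrue L b) x))
      + sumCells L (λ b → count (λ x → h x ∧ cellᵇ (suc L) g (withFalse L b) x))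
      ≡⟨ cong₂ _+_ (trans (sumCells-cong L (count-withTrue L g h)) (sumCells-count L _ (λ x → h x ∧ g₀ x)))
                   (trans (sumCells-cong L (count-withFalse L g h)) (sumCells-count L _ (λ x → h x ∧ bnot (g₀ x)))) ⟩
    count (λ x → h x ∧ g₀ x) + count (λ x → h x ∧ bnot (g₀ x))
      ≡⟨ countBelow-split h g₀ n ⟨
    count h ∎
    where
    open ≡-Reasoning
    g₀ : ℕ → Bool
    g₀ = g Fin.zero

  sumCellsIn-count : ∀ L (g : Fin L → ℕ → Bool) (h : ℕ → Bool) l →
    sumCellsIn L l (λ b → count (λ x → h x ∧ cellᵇ L g b x)) ≡ count (λ x → h x ∧ g l x)
  sumCellsIn-count (suc L) g h Fin.zero =
    trans (sumCells-cong L (count-withTrue L g h)) (sumCells-count L (g ∘ Fin.suc) (λ x → h x ∧ g Fin.zero x))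
  sumCellsIn-count (suc L) g h (Fin.suc l) = begin
    sumCellsIn L l (λ b → count (λ x → h x ∧ cellᵇ (suc L) g (withTrue L b) x))
      + sumCellsIn L l (λ b → count (λ x → h x ∧ cellᵇ (suc L) g (withFalse L b) x))
      ≡⟨ cong₂ _+_ (trans (sumCellsIn-cong L l (count-withTrue L g h)) (sumCellsIn-count L _ (λ x → h x ∧ g₀ x) l))
                   (trans (sumCellsIn-cong L l (count-withFalse L g h))
                          (sumCellsIn-count L _ (λ x → h x ∧ bnot (g₀ x)) l)) ⟩
    count (λ x → (h x ∧ g₀ x) ∧ gₗ x) + count (λ x → (h x ∧ bnot (g₀ x)) ∧ gₗ x)
      ≡⟨ cong₂ _+_ (countBelow-cong n (λ {x} _ → ∧-swapʳ (h x) (g₀ x) (gₗ x)))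
                   (countBelow-cong n (λ {x} _ → ∧-swapʳ (h x) (bnot (g₀ x)) (gₗ x))) ⟩
    count (λ x → (h x ∧ gₗ x) ∧ g₀ x) + count (λ x → (h x ∧ gₗ x) ∧ bnot (g₀ x))
      ≡⟨ countBelow-split (λ x → h x ∧ gₗ x) g₀ n ⟨
    count (λ x → h x ∧ gₗ x) ∎
    where
    open ≡-Reasoning
    g₀ gₗ : ℕ → Bool
    g₀ = g Fin.zero
    gₗ = g (Fin.suc l)
    ∧-swapʳ : ∀ a b c → (a ∧ b) ∧ c ≡ (a ∧ c) ∧ b
    ∧-swapʳ a b c = trans (BoolP.∧-assoc a b c)
      (trans (cong (a ∧_) (BoolP.∧-comm b c)) (sym (BoolP.∧-assoc a c b)))

-- Semantics of the derived connectives and of cells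

⋀-cong : ∀ K {f g : Fin K → Form} → (∀ j → f j ≡ g j) → ⋀ K f ≡ ⋀ K g
⋀-cong zero    f≡g = refl
⋀-cong (suc K) f≡g = cong₂ _∧'_ (f≡g Fin.zero) (⋀-cong K (λ j → f≡g (Fin.suc j)))

Sat-tt' : ∀ M ρ → Sat M ρ tt'
Sat-tt' M ρ = + 0 , + 0 , refl , refl , refl

Sat-⋀⁺ : ∀ M ρ K f → (∀ j → Sat M ρ (f j)) → Sat M ρ (⋀ K f)
Sat-⋀⁺ M ρ zero    f sat = Sat-tt' M ρ
Sat-⋀⁺ M ρ (suc K) f sat = sat Fin.zero , Sat-⋀⁺ M ρ K _ (λ j → sat (Fin.suc j))

Sat-⋀⁻ : ∀ M ρ K f → Sat M ρ (⋀ K f) → ∀ j → Sat M ρ (f j)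
Sat-⋀⁻ M ρ (suc K) f (s , _) Fin.zero    = s
Sat-⋀⁻ M ρ (suc K) f (_ , s) (Fin.suc j) = Sat-⋀⁻ M ρ K _ s j

Sat-⋁⁺ : ∀ M ρ K f j → Sat M ρ (f j) → Sat M ρ (⋁ K f)
Sat-⋁⁺ M ρ (suc K) f Fin.zero    s (¬s , _)  = ¬s s
Sat-⋁⁺ M ρ (suc K) f (Fin.suc j) s (_ , ¬ss) = ¬ss (Sat-⋁⁺ M ρ K _ j s)

Sat-eq-var : ∀ M ρ i k → Sat M ρ (eq (var i) (var k)) ⇔ (ρ i ≡ ρ k)
Sat-eq-var M ρ i k = mk⇔ (λ (u , w , eu , ew , u≡w) → trans (sym eu) (trans u≡w ew))
                         (λ ρi≡ρk → ρ i , ρ k , refl , refl , ρi≡ρk)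

¬T⇔T-not : ∀ {a} → (¬ T a) ⇔ T (bnot a)
¬T⇔T-not {false} = mk⇔ (λ _ → tt) (λ _ ())
¬T⇔T-not {true}  = mk⇔ (λ ¬T → ¬T tt) (λ ())

Sat-cell : ∀ M ρ L (Γ : Fin L → Form) (g : Fin L → ℕ → Bool) x →
           (∀ l → Sat M ρ (Γ l) ⇔ T (g l x)) → ∀ b → Sat M ρ (cell L Γ b) ⇔ T (cellᵇ L g b x)
Sat-cell M ρ zero    Γ g x Γ⇔g b = mk⇔ (λ _ → tt) (λ _ → Sat-tt' M ρ)
Sat-cell M ρ (suc L) Γ g x Γ⇔g b with splitAt (pow2 L) b
... | inj₁ b' = ⇔.trans (Γ⇔g Fin.zero
                          ×-⇔ Sat-cell M ρ L (Γ ∘ Fin.suc) (g ∘ Fin.suc) x (Γ⇔g ∘ Fin.suc) b')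
                       (⇔.sym BoolP.T-∧)
... | inj₂ b' = ⇔.trans ((⇔.trans (¬-cong-⇔ (Γ⇔g Fin.zero)) ¬T⇔T-not)
                          ×-⇔ Sat-cell M ρ L (Γ ∘ Fin.suc) (g ∘ Fin.suc) x (Γ⇔g ∘ Fin.suc) b')
                       (⇔.sym BoolP.T-∧)

cell-cover : ExcludedMiddle 0ℓ → ∀ M ρ L Γ → Σ (Fin (pow2 L)) λ b → Sat M ρ (cell L Γ b)
cell-cover em M ρ zero    Γ = Fin.zero , Sat-tt' M ρ
cell-cover em M ρ (suc L) Γ with cell-cover em M ρ L (λ l → Γ (Fin.suc l)) | em {Sat M ρ (Γ Fin.zero)}
... | b , s | yes sΓ₀ = withTrue L b ,
  subst (Sat M ρ) (sym (cellWith-withTrue _∧'_ not tt' L Γ b)) (sΓ₀ , s)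
... | b , s | no ¬sΓ₀ = withFalse L b ,
  subst (Sat M ρ) (sym (cellWith-withFalse _∧'_ not tt' L Γ b)) (¬sΓ₀ , s)

cell-disjoint : ∀ M ρ L Γ b b' → Sat M ρ (cell L Γ b) → Sat M ρ (cell L Γ b') → b ≡ b'
cell-disjoint M ρ zero Γ Fin.zero Fin.zero s s' = refl
cell-disjoint M ρ (suc L) Γ b b' s s' with splitAt (pow2 L) b in eq₁ | splitAt (pow2 L) b' in eq₂
... | inj₁ c | inj₁ c' with cell-disjoint M ρ L (λ l → Γ (Fin.suc l)) c c' (proj₂ s) (proj₂ s')
...   | refl = trans (sym (FinP.splitAt⁻¹-↑ˡ eq₁)) (FinP.splitAt⁻¹-↑ˡ eq₂)
cell-disjoint M ρ (suc L) Γ b b' s s' | inj₁ c | inj₂ c' = ⊥-elim (proj₁ s' (proj₁ s))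
cell-disjoint M ρ (suc L) Γ b b' s s' | inj₂ c | inj₁ c' = ⊥-elim (proj₁ s (proj₁ s'))
cell-disjoint M ρ (suc L) Γ b b' s s' | inj₂ c | inj₂ c'
  with cell-disjoint M ρ L (λ l → Γ (Fin.suc l)) c c' (proj₂ s) (proj₂ s')
... | refl = trans (sym (FinP.splitAt⁻¹-↑ʳ eq₁)) (FinP.splitAt⁻¹-↑ʳ eq₂)

T-injective : ∀ {a b} → T a ⇔ T b → a ≡ b
T-injective Ta⇔Tb = BoolP.⇔→≡ (⇔.trans (⇔.sym BoolP.T-≡) (⇔.trans Ta⇔Tb BoolP.T-≡))

<clamp⇒+< : ∀ {i} N → i < clamp N → + i ℤ.< N
<clamp⇒+< (+ n) i<n = ℤ.+<+ i<n

+<⇒<clamp : ∀ {i} N → + i ℤ.< N → i < clamp N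
+<⇒<clamp (+ n) (ℤ.+<+ i<n) = i<n

Eval-card : ∀ M ρ φ (g : ℕ → Bool) →
  (∀ i → + i ℤ.< Str.N M → Sat M ((+ i) ∷ᵉ ρ) φ ⇔ T (g i)) →
  ∀ v → Eval M ρ (card φ) v ⇔ (v ≡ + countBelow g (clamp (Str.N M)))
Eval-card M ρ φ g φ⇔g v = mk⇔
  (λ (P , P⇔φ , v≡) → trans v≡ (cong +_ (countBelow-cong (clamp (Str.N M)) λ {i} i<N →
     T-injective (⇔.trans (P⇔φ i (<clamp⇒+< (Str.N M) i<N)) (φ⇔g i (<clamp⇒+< (Str.N M) i<N))))))
  (λ v≡ → g , (λ i i<N → ⇔.sym (φ⇔g i i<N)) , v≡)

mutual
  ArithT-subT : ∀ {τ} → (∀ i → Σ ℕ λ k → τ i ≡ var k) → ∀ t → ArithT t → ArithT (subT τ t)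
  ArithT-subT τ-var (num _) a = a
  ArithT-subT τ-var (par _) a = a
  ArithT-subT τ-var Npar    a = a
  ArithT-subT τ-var (var i) a with τ-var i
  ... | k , e rewrite e = tt
  ArithT-subT τ-var (t ⊕ s) (at , as) = ArithT-subT τ-var t at , ArithT-subT τ-var s as
  ArithT-subT τ-var (neg t) at = ArithT-subT τ-var t at

  Arith-subF : ∀ {τ} → (∀ i → Σ ℕ λ k → τ i ≡ var k) → ∀ φ → Arith φ → Arith (subF τ φ)
  Arith-subF τ-var (lt t s)    (at , as) = ArithT-subT τ-var t at , ArithT-subT τ-var s as
  Arith-subF τ-var (eq t s)    (at , as) = ArithT-subT τ-var t at , ArithT-subT τ-var s as
  Arith-subF τ-var (cng _ t s) (at , as) = ArithT-subT τ-var t at , ArithT-subT τ-var s as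
  Arith-subF τ-var (φ ∧' ψ)    (aφ , aψ) = Arith-subF τ-var φ aφ , Arith-subF τ-var ψ aψ
  Arith-subF τ-var (not φ)     aφ        = Arith-subF τ-var φ aφ
  Arith-subF {τ} τ-var (ex φ)  aφ        = Arith-subF exts-var φ aφ
    where
    exts-var : ∀ i → Σ ℕ λ k → exts τ i ≡ var k
    exts-var zero = 0 , refl
    exts-var (suc i) with τ-var i
    ... | k , e rewrite e = suc k , refl

Arith-tt' : Arith tt'
Arith-tt' = tt , tt

Arith-⋀ : ∀ K f → (∀ j → Arith (f j)) → Arith (⋀ K f)
Arith-⋀ zero    f ar = Arith-tt'
Arith-⋀ (suc K) f ar = ar Fin.zero , Arith-⋀ K _ (λ j → ar (Fin.suc j))

Arith-cell : ∀ L Γ → (∀ l → Arith (Γ l)) → ∀ b → Arith (cell L Γ b)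
Arith-cell zero    Γ ar b = Arith-tt'
Arith-cell (suc L) Γ ar b with splitAt (pow2 L) b
... | inj₁ b' = ar Fin.zero , Arith-cell L _ (λ l → ar (Fin.suc l)) b'
... | inj₂ b' = ar Fin.zero , Arith-cell L _ (λ l → ar (Fin.suc l)) b'

sumCellsT : (L : ℕ) → (Fin (pow2 L) → Term) → Term
sumCellsT zero    f = f Fin.zero
sumCellsT (suc L) f = sumCellsT L (λ b → f (withTrue L b)) ⊕ sumCellsT L (λ b → f (withFalse L b))

sumCellsInT : (L : ℕ) → Fin L → (Fin (pow2 L) → Term) → Term
sumCellsInT (suc L) Fin.zero    f = sumCellsT L (λ b → f (withTrue L b))
sumCellsInT (suc L) (Fin.suc l) f =
  sumCellsInT L l (λ b → f (withTrue L b)) ⊕ sumCellsInT L l (λ b → f (withFalse L b))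

ArithT-sumCellsT : ∀ L f → (∀ b → ArithT (f b)) → ArithT (sumCellsT L f)
ArithT-sumCellsT zero    f ar = ar Fin.zero
ArithT-sumCellsT (suc L) f ar =
  ArithT-sumCellsT L _ (λ b → ar (withTrue L b)) , ArithT-sumCellsT L _ (λ b → ar (withFalse L b))

ArithT-sumCellsInT : ∀ L l f → (∀ b → ArithT (f b)) → ArithT (sumCellsInT L l f)
ArithT-sumCellsInT (suc L) Fin.zero    f ar = ArithT-sumCellsT L _ (λ b → ar (withTrue L b))
ArithT-sumCellsInT (suc L) (Fin.suc l) f ar =
  ArithT-sumCellsInT L l _ (λ b → ar (withTrue L b)) , ArithT-sumCellsInT L l _ (λ b → ar (withFalse L b))

fvbT-sumCellsT≤ : ∀ {B} L f → (∀ b → fvbT (f b) ≤ B) → fvbT (sumCellsT L f) ≤ B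
fvbT-sumCellsT≤ zero    f bound = bound Fin.zero
fvbT-sumCellsT≤ (suc L) f bound =
  ℕP.⊔-lub (fvbT-sumCellsT≤ L _ (λ b → bound (withTrue L b)))
           (fvbT-sumCellsT≤ L _ (λ b → bound (withFalse L b)))

fvbT-sumCellsInT≤ : ∀ {B} L l f → (∀ b → fvbT (f b) ≤ B) → fvbT (sumCellsInT L l f) ≤ B
fvbT-sumCellsInT≤ (suc L) Fin.zero    f bound = fvbT-sumCellsT≤ L _ (λ b → bound (withTrue L b))
fvbT-sumCellsInT≤ (suc L) (Fin.suc l) f bound =
  ℕP.⊔-lub (fvbT-sumCellsInT≤ L l _ (λ b → bound (withTrue L b)))
           (fvbT-sumCellsInT≤ L l _ (λ b → bound (withFalse L b)))

module _ (M : Str) (ρ : Env) where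
  Denotes : Term → ℕ → Set
  Denotes t c = ∀ v → Eval M ρ t v ⇔ (v ≡ + c)

  Denotes-var : ∀ {k c} → ρ k ≡ + c → Denotes (var k) c
  Denotes-var ρk≡c v = mk⇔ (λ v≡ρk → trans v≡ρk ρk≡c) (λ v≡c → trans v≡c (sym ρk≡c))

  Eval-⊕ : ∀ {t s a b} → Denotes t a → Denotes s b → Denotes (t ⊕ s) (a + b)
  Eval-⊕ t≐a s≐b v = mk⇔
    (λ (u , w , et , es , v≡) → trans v≡ (cong₂ ℤ._+_ (to (t≐a u) et) (to (s≐b w) es)))
    (λ v≡ → _ , _ , from (t≐a _) refl , from (s≐b _) refl , v≡)

  Eval-sumCellsT : ∀ L {f c} → (∀ b → Denotes (f b) (c b)) → Denotes (sumCellsT L f) (sumCells L c)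
  Eval-sumCellsT zero    f≐c = f≐c Fin.zero
  Eval-sumCellsT (suc L) f≐c =
    Eval-⊕ (Eval-sumCellsT L (λ b → f≐c (withTrue L b))) (Eval-sumCellsT L (λ b → f≐c (withFalse L b)))

  Eval-sumCellsInT : ∀ L l {f c} → (∀ b → Denotes (f b) (c b)) → Denotes (sumCellsInT L l f) (sumCellsIn L l c)
  Eval-sumCellsInT (suc L) Fin.zero    f≐c = Eval-sumCellsT L (λ b → f≐c (withTrue L b))
  Eval-sumCellsInT (suc L) (Fin.suc l) f≐c =
    Eval-⊕ (Eval-sumCellsInT L l (λ b → f≐c (withTrue L b))) (Eval-sumCellsInT L l (λ b → f≐c (withFalse L b)))

-- From an E-flat formula to a partition sentence

BasicSubst : (ℕ → Term) → Set
BasicSubst σ = (i : ℕ) → (σ i ≡ var i) ⊎ Σ ℕ λ a → Σ ℕ λ y → σ i ≡ app a (var y)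

BasicSubst⇒ReadSubst : ∀ {σ} → BasicSubst σ → ReadSubst σ
BasicSubst⇒ReadSubst bs i with bs i
... | inj₁ e           = inj₁ (i , e)
... | inj₂ (a , y , e) = inj₂ (a , y , e)

maxF : (K : ℕ) → (Fin K → ℕ) → ℕ
maxF zero    f = 0
maxF (suc K) f = f Fin.zero ⊔ maxF K (λ j → f (Fin.suc j))

≤maxF : ∀ K f j → f j ≤ maxF K f
≤maxF (suc K) f Fin.zero    = ℕP.m≤m⊔n _ _
≤maxF (suc K) f (Fin.suc j) = ℕP.m≤n⇒m≤o⊔n _ (≤maxF K _ j)

module FlatToPartition (em : ExcludedMiddle 0ℓ) (K : ℕ)
  (ψα : Form) (arα : Arith ψα) (σα : ℕ → Term) (bsα : BasicSubst σα)
  (ψβ : Fin K → Form) (arβ : ∀ j → Arith (ψβ j))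
  (σβ : Fin K → ℕ → Term) (bsβ : ∀ j → BasicSubst (σβ j)) where

  α : Form
  α = subF σα ψα

  β : Fin K → Form
  β j = subF (σβ j) (ψβ j)

  body : Form
  body = flatBody K 0 α β

  -- Variables of the new body: 0 … V-1 are those of the old one (z₁ … z_K, then the free
  -- variables of the closure), V + i + c * A holds the value of the term substituted for
  -- variable i of ψα (c = 0) or of ψβ_j (c = 1 + j), and m + b is the size of cell b.
  -- Inside the cardinalities, index H + a stands for the array read a(x).
  V A S m H L K' : ℕ
  V  = fvb (exN K body) + K
  A  = suc (fvb ψα ⊔ maxF K (λ j → fvb (ψβ j)))
  S  = suc K * A
  m  = V + S
  H  = suc m
  L  = K + S
  K' = pow2 L

  -- What σα or σβ_j substitutes for a variable: old variable w, a(w), x, a(x), or nothing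
  -- within range (then the variable does not occur).
  data Role : Set where
    old      : (w : ℕ) → w < V → Role
    oldRead  : ℕ → (w : ℕ) → w < V → Role
    bound    : Role
    boundRead : ℕ → Role
    unused   : Role

  roleα : ℕ → Role
  roleα i with bsα i
  ... | inj₁ _ with i <? V
  ...   | yes i<V = old i i<V
  ...   | no _    = unused
  roleα i | inj₂ (a , y , _) with y <? V
  ...   | yes y<V = oldRead a y y<V
  ...   | no _    = unused

  roleβ : Fin K → ℕ → Role
  roleβ j i with bsβ j i
  roleβ j zero    | inj₁ _ = bound
  roleβ j (suc i) | inj₁ _ with i <? V
  ...   | yes i<V = old i i<V
  ...   | no _    = unused
  roleβ j i | inj₂ (a , zero , _) = boundRead a
  roleβ j i | inj₂ (a , suc y , _) with y <? V
  ...   | yes y<V = oldRead a y y<V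
  ...   | no _    = unused

  role : ℕ → ℕ → Role
  role zero    i = roleα i
  role (suc c) i with c <? K
  ... | yes c<K = roleβ (fromℕ< c<K) i
  ... | no _    = unused

  slot : ℕ → ℕ → ℕ
  slot c i = i + c * A

  slotRole : ℕ → Role
  slotRole s = role (s / A) (s % A)

  τα : ℕ → Term
  τα i = var (V + slot 0 (i % A))

  τβ : Fin K → ℕ → Term
  τβ j i = byRole (roleβ j i) (V + slot (suc (toℕ j)) (i % A))
    where
    byRole : Role → ℕ → Term
    byRole bound         s = var 0
    byRole (boundRead a) s = var (H + a)
    byRole _             s = var (suc s)

  slotCheck : Role → ℕ → Form
  slotCheck (oldRead a w _) s = eq (var 0) (var (suc w)) ∧' not (eq (var (H + a)) (var (suc (V + s))))
  slotCheck _               s = ff'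

  Γ : Fin L → Form
  Γ l = [ (λ j → subF (τβ j) (ψβ j)) , (λ s → slotCheck (slotRole (toℕ s)) (toℕ s)) ]′ (splitAt K l)

  cellSize : Fin K' → Term
  cellSize b = var (m + toℕ b)

  -- Cardinalities only see x ∈ [0,N), while a(w) = 0 for w outside it.
  inRangeOrZero : ℕ → ℕ → Form
  inRangeOrZero w s = (not (lt (var w) (num (+ 0))) ∧' lt (var w) Npar) ∨' eq (var s) (num (+ 0))

  slotEquation : Role → Fin S → Form
  slotEquation (old w _)       s = eq (var (V + toℕ s)) (var w)
  slotEquation (oldRead a w _) s =
    eq (sumCellsInT L (K ↑ʳ s) cellSize) (num (+ 0)) ∧' inRangeOrZero w (V + toℕ s)
  slotEquation _               s = tt'

  countEquation : Fin K → Form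
  countEquation j = eq (var (toℕ j)) (sumCellsInT L (j ↑ˡ S) cellSize)

  slotEquationAt : Fin S → Form
  slotEquationAt s = slotEquation (slotRole (toℕ s)) s

  α' : Form
  α' = subF τα ψα ∧' (⋀ K countEquation ∧' ⋀ S slotEquationAt)

  χ : ℕ → Term
  χ i with i <? H
  ... | yes _ = var i
  ... | no _  = app (i ∸ H) (var 0)

  β' : Fin K' → Form
  β' b = subF χ (cell L Γ b)

  body' : Form
  body' = flatBody K' m α' β'

  θ : Form
  θ = exN K' (exN m body')

  χ-shape : ∀ i → (χ i ≡ var i) ⊎ Σ ℕ λ a → χ i ≡ app a (var 0)
  χ-shape i with i <? H
  ... | yes _ = inj₁ refl
  ... | no _  = inj₂ (i ∸ H , refl)

  χ-ReadSubst : ReadSubst χ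
  χ-ReadSubst i with χ-shape i
  ... | inj₁ e       = inj₁ (i , e)
  ... | inj₂ (a , e) = inj₂ (a , 0 , e)

  τβ-var : ∀ j i → Σ ℕ λ k → τβ j i ≡ var k
  τβ-var j i with roleβ j i
  ... | old _ _       = _ , refl
  ... | oldRead _ _ _ = _ , refl
  ... | bound         = 0 , refl
  ... | boundRead a   = H + a , refl
  ... | unused        = _ , refl

  Arith-Γ : ∀ l → Arith (Γ l)
  Arith-Γ l with splitAt K l
  ... | inj₁ j = Arith-subF (τβ-var j) (ψβ j) (arβ j)
  ... | inj₂ s = Arith-slotCheck (slotRole (toℕ s))
    where
    Arith-slotCheck : ∀ r → Arith (slotCheck r (toℕ s))
    Arith-slotCheck (old _ _)       = Arith-tt'
    Arith-slotCheck (oldRead _ _ _) = (tt , tt) , (tt , tt)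
    Arith-slotCheck bound           = Arith-tt'
    Arith-slotCheck (boundRead _)   = Arith-tt'
    Arith-slotCheck unused          = Arith-tt'

  Arith-α' : Arith α'
  Arith-α' = Arith-subF (λ i → _ , refl) ψα arα
           , Arith-⋀ K countEquation (λ j → tt , ArithT-sumCellsInT L (j ↑ˡ S) cellSize (λ _ → tt))
           , Arith-⋀ S slotEquationAt (λ s → Arith-slotEquation (slotRole (toℕ s)) s)
    where
    Arith-slotEquation : ∀ r s → Arith (slotEquation r s)
    Arith-slotEquation (old _ _)       s = tt , tt
    Arith-slotEquation (oldRead _ _ _) s =
      (ArithT-sumCellsInT L (K ↑ʳ s) cellSize (λ _ → tt) , tt) , ((tt , tt) , (tt , tt)) , (tt , tt)
    Arith-slotEquation bound           s = Arith-tt'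
    Arith-slotEquation (boundRead _)   s = Arith-tt'
    Arith-slotEquation unused          s = Arith-tt'

  BasicX-β' : ∀ b → BasicX (β' b)
  BasicX-β' b = cell L Γ b , Arith-cell L Γ Arith-Γ b , χ , χ-shape , refl

  m≤m+K' : m ≤ m + K'
  m≤m+K' = ℕP.m≤m+n m K'

  fvbT-cellSize≤ : ∀ b → fvbT (cellSize b) ≤ m + K'
  fvbT-cellSize≤ b = ℕP.+-monoʳ-< m (FinP.toℕ<n b)

  fvb-α'≤ : fvb α' ≤ m + K'
  fvb-α'≤ = ℕP.⊔-lub (ℕP.≤-trans (fvb-subF≤ (λ i → inj₁ (_ , refl)) τα≤ ψα arα) m≤m+K')
              (ℕP.⊔-lub (fvb-⋀≤ K countEquation (λ j →
                           ℕP.⊔-lub (old≤ (ℕP.≤-trans (FinP.toℕ<n j) (ℕP.m≤n+m K _)))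
                                    (fvbT-sumCellsInT≤ L (j ↑ˡ S) cellSize fvbT-cellSize≤)))
                        (fvb-⋀≤ S slotEquationAt slotEquation≤))
    where
    slot≤ : ∀ {s} → s < S → suc (V + s) ≤ m + K'
    slot≤ s<S = ℕP.≤-trans (ℕP.+-monoʳ-< V s<S) m≤m+K'

    old≤ : ∀ {w} → w < V → suc w ≤ m + K'
    old≤ w<V = ℕP.≤-trans w<V (ℕP.≤-trans (ℕP.m≤m+n V S) m≤m+K')

    τα≤ : ∀ i → fvbT (τα i) ≤ m
    τα≤ i = ℕP.+-monoʳ-< V (ℕP.<-≤-trans (ℕP.≤-reflexive (cong suc (ℕP.+-identityʳ (i % A))))
                              (ℕP.≤-trans (DivMod.m%n<n i A) (ℕP.m≤m+n A (K * A))))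

    slotEquation≤ : ∀ s → fvb (slotEquationAt s) ≤ m + K'
    slotEquation≤ s with slotRole (toℕ s)
    ... | old w w<V = ℕP.⊔-lub (slot≤ (FinP.toℕ<n s)) (old≤ w<V)
    ... | oldRead a w w<V =
      ℕP.⊔-lub (ℕP.⊔-lub (fvbT-sumCellsInT≤ L (K ↑ʳ s) cellSize fvbT-cellSize≤) z≤n)
               (ℕP.⊔-lub (ℕP.⊔-lub (ℕP.⊔-lub (old≤ w<V) z≤n) (ℕP.⊔-lub (old≤ w<V) z≤n))
                         (ℕP.⊔-lub (slot≤ (FinP.toℕ<n s)) z≤n))
    ... | bound       = z≤n
    ... | boundRead _ = z≤n
    ... | unused      = z≤n

  fvb-β'≤ : ∀ b → fvb (β' b) ∸ 1 ≤ m + K'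
  fvb-β'≤ b = ℕP.≤-trans
    (ℕP.∸-monoˡ-≤ 1 (fvb-subF≤ χ-ReadSubst χ≤ (cell L Γ b) (Arith-cell L Γ Arith-Γ b))) m≤m+K'
    where
    χ≤ : ∀ k → fvbT (χ k) ≤ H
    χ≤ k with k <? H
    ... | yes k<H = k<H
    ... | no _    = s≤s z≤n

  fvb-θ : fvb θ ≡ 0
  fvb-θ = begin
    fvb (exN K' (exN m body')) ≡⟨ fvb-exN K' (exN m body') ⟩
    fvb (exN m body') ∸ K'     ≡⟨ cong (_∸ K') (fvb-exN m body') ⟩
    fvb body' ∸ m ∸ K'         ≡⟨ ℕP.∸-+-assoc (fvb body') m K' ⟩
    fvb body' ∸ (m + K')       ≡⟨ ℕP.m≤n⇒m∸n≡0 fvb-body'≤ ⟩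
    0                          ∎
    where
    open ≡-Reasoning
    fvb-body'≤ : fvb body' ≤ m + K'
    fvb-body'≤ = ℕP.⊔-lub fvb-α'≤ (fvb-⋀≤ K' _ (λ b → ℕP.⊔-lub (fvb-β'≤ b) (fvbT-cellSize≤ b)))

  readEnv : Str → Env → Env
  readEnv M ρ k with k <? H
  ... | yes _ = ρ k
  ... | no _  = Str.arr M (k ∸ H) (ρ 0)

  Sat-β' : ∀ M ρ b → Sat M ρ (β' b) ⇔ Sat M (readEnv M ρ) (cell L Γ b)
  Sat-β' M ρ b = Sat-subF M (cell L Γ b) χ-ReadSubst (λ k _ → χ-denotes k) (Arith-cell L Γ Arith-Γ b)
    where
    χ-denotes : ∀ k → Eval M ρ (χ k) (readEnv M ρ k)
    χ-denotes k with k <? H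
    ... | yes _ = refl
    ... | no _  = ρ 0 , refl , refl

  partition : Partition K' β'
  partition = covers , disjoint
    where
    covers : Valid (⋁ K' β')
    covers M ρ with cell-cover em M (readEnv M ρ) L Γ
    ... | b , s = Sat-⋁⁺ M ρ K' β' b (from (Sat-β' M ρ b) s)

    disjoint : (b b' : Fin K') → b ≢ b' → Valid (not (β' b ∧' β' b'))
    disjoint b b' b≢b' M ρ (s , s') =
      b≢b' (cell-disjoint M (readEnv M ρ) L Γ b b' (to (Sat-β' M ρ b) s) (to (Sat-β' M ρ b') s'))

  slot-% : ∀ c {i} → i < A → slot c i % A ≡ i
  slot-% c {i} i<A = trans (DivMod.[m+kn]%n≡m%n i c A) (DivMod.m<n⇒m%n≡m i<A)

  slot-/ : ∀ c {i} → i < A → slot c i / A ≡ c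
  slot-/ c {i} i<A = trans (DivMod.+-distrib-/-∣ʳ i (divides-refl c))
                           (cong₂ _+_ (DivMod.m<n⇒m/n≡0 i<A) (DivMod.m*n/n≡m c A))

  slotRole-slot : ∀ c {i} → i < A → slotRole (slot c i) ≡ role c i
  slotRole-slot c i<A = cong₂ role (slot-/ c i<A) (slot-% c i<A)

  role-suc : ∀ j i → role (suc (toℕ j)) i ≡ roleβ j i
  role-suc j i with toℕ j <? K
  ... | yes j<K = cong (λ j' → roleβ j' i) (FinP.fromℕ<-toℕ j j<K)
  ... | no j≮K  = ⊥-elim (j≮K (FinP.toℕ<n j))

  slot<S : ∀ {c i} → c ≤ K → i < A → slot c i < S
  slot<S {c} c≤K i<A = ℕP.<-≤-trans (ℕP.+-monoˡ-< (c * A) i<A) (ℕP.*-monoˡ-≤ A (s≤s c≤K))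

  V+s<m : ∀ {s} → s < S → V + s < m
  V+s<m s<S = ℕP.+-monoʳ-< V s<S

  readEnv-< : ∀ M ρ {k} → k < H → readEnv M ρ k ≡ ρ k
  readEnv-< M ρ {k} k<H with k <? H
  ... | yes _  = refl
  ... | no k≮H = ⊥-elim (k≮H k<H)

  readEnv-H+ : ∀ M ρ a → readEnv M ρ (H + a) ≡ Str.arr M a (ρ 0)
  readEnv-H+ M ρ a with (H + a) <? H
  ... | yes H+a<H = ⊥-elim (ℕP.<-irrefl refl (ℕP.≤-<-trans (ℕP.m≤m+n H a) H+a<H))
  ... | no _      = cong (λ b → Str.arr M b (ρ 0)) (ℕP.m+n∸m≡n H a)

  readEnv-agree : ∀ M {F F'} d → (∀ {i} → i < m → F i ≡ F' i) →
                  readEnv M (d ∷ᵉ F) ≗ readEnv M (d ∷ᵉ F')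
  readEnv-agree M d agree k with k <? H
  readEnv-agree M d agree zero    | yes _         = refl
  readEnv-agree M d agree (suc k) | yes (s≤s k<m) = agree k<m
  ... | no _ = refl

  cellEnv : Str → Env → ℕ → Env
  cellEnv M F x = readEnv M ((+ x) ∷ᵉ F)

  body≤V : fvb body ≤ V
  body≤V = subst (fvb body ≤_) (trans (ℕP.+-comm K _) (cong (_+ K) (sym (fvb-exN K body))))
                 (ℕP.m≤n+m∸n (fvb body) K)

  α≤V : fvb α ≤ V
  α≤V = ℕP.≤-trans (ℕP.m≤m⊔n _ _) body≤V

  β≤V : ∀ j → fvb (β j) ∸ 1 ≤ V
  β≤V j = ℕP.≤-trans (ℕP.m≤m⊔n _ _)
          (ℕP.≤-trans (fvb≤fvb-⋀ K (λ j → eq (card (β j)) (var (toℕ j))) j)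
                      (ℕP.≤-trans (ℕP.m≤n⊔m _ _) body≤V))

  ψα<A : ∀ {k} → Occurs k ψα → k < A
  ψα<A o = ℕP.≤-trans (Occurs⇒<fvb ψα o) (ℕP.≤-trans (ℕP.m≤m⊔n _ _) (ℕP.n≤1+n _))

  ψβ<A : ∀ j {k} → Occurs k (ψβ j) → k < A
  ψβ<A j o = ℕP.≤-trans (Occurs⇒<fvb (ψβ j) o)
    (ℕP.≤-trans (≤maxF K (λ j → fvb (ψβ j)) j) (ℕP.≤-trans (ℕP.m≤n⊔m _ _) (ℕP.n≤1+n _)))

  valα : Str → Env → ℕ → ℤ
  valα M B k with bsα k
  ... | inj₁ _           = B k
  ... | inj₂ (a , y , _) = Str.arr M a (B y)

  valβ : Str → Env → Fin K → ℤ → ℕ → ℤ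
  valβ M B j x k with bsβ j k
  ... | inj₁ _           = (x ∷ᵉ B) k
  ... | inj₂ (a , y , _) = Str.arr M a ((x ∷ᵉ B) y)

  σα-denotes : ∀ M B k → Eval M B (σα k) (valα M B k)
  σα-denotes M B k with bsα k
  ... | inj₁ e           rewrite e = refl
  ... | inj₂ (a , y , e) rewrite e = B y , refl , refl

  σβ-denotes : ∀ M B j x k → Eval M (x ∷ᵉ B) (σβ j k) (valβ M B j x k)
  σβ-denotes M B j x k with bsβ j k
  ... | inj₁ e           rewrite e = refl
  ... | inj₂ (a , y , e) rewrite e = (x ∷ᵉ B) y , refl , refl

  Holds : Str → Env → Env → Role → ℕ → Set
  Holds M B E (old w _)       p = E p ≡ B w
  Holds M B E (oldRead a w _) p = E p ≡ Str.arr M a (B w)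
  Holds M B E _               p = ⊤'

  Consistent : Str → Env → Env → Set
  Consistent M B E = (∀ {i} → i < V → E i ≡ B i) × (∀ {s} → s < S → Holds M B E (slotRole s) (V + s))

  Holds-role : ∀ {M B E} → Consistent M B E → ∀ c {i} → c ≤ K → i < A →
               Holds M B E (role c i) (V + slot c (i % A))
  Holds-role (_ , holds) c {i} c≤K i<A rewrite DivMod.m<n⇒m%n≡m i<A =
    subst (λ r → Holds _ _ _ r (V + slot c i)) (slotRole-slot c i<A) (holds (slot<S c≤K i<A))

  τα-denotes : ∀ M B E → Consistent M B E → ∀ k → Occurs k ψα → Eval M E (τα k) (valα M B k)
  τα-denotes M B E cons k o = go (Holds-role cons 0 z≤n (ψα<A o))
    where
    fvb-σαk≤V : fvbT (σα k) ≤ V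
    fvb-σαk≤V = ℕP.≤-trans (fvbT-σ≤fvb-subF (BasicSubst⇒ReadSubst bsα) ψα o) α≤V
    go : Holds M B E (roleα k) (V + slot 0 (k % A)) → Eval M E (τα k) (valα M B k)
    go holds with bsα k
    ... | inj₁ e with k <? V
    ...   | yes _  = sym holds
    ...   | no k≮V = ⊥-elim (k≮V (subst (λ t → fvbT t ≤ V) e fvb-σαk≤V))
    go holds | inj₂ (a , y , e) with y <? V
    ...   | yes _  = sym holds
    ...   | no y≮V = ⊥-elim (y≮V (subst (λ t → fvbT t ≤ V) e fvb-σαk≤V))

  τβ-denotes : ∀ M B E → Consistent M B E → ∀ j x k → Occurs k (ψβ j) →
               Eval M (cellEnv M E x) (τβ j k) (valβ M B j (+ x) k)
  τβ-denotes M B E cons j x k o =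
    go k (subst (λ r → Holds M B E r (V + slot c (k % A))) (role-suc j k)
                (Holds-role cons c (FinP.toℕ<n j) (ψβ<A j o)))
         fvb-σβk≤1+V
    where
    c : ℕ
    c = suc (toℕ j)
    X : Env
    X = (+ x) ∷ᵉ E
    fvb-σβk≤1+V : fvbT (σβ j k) ≤ suc V
    fvb-σβk≤1+V = ℕP.≤-trans (ℕP.m≤n+m∸n _ 1) (ℕP.+-monoʳ-≤ 1 (ℕP.≤-trans
      (ℕP.∸-monoˡ-≤ 1 (fvbT-σ≤fvb-subF (BasicSubst⇒ReadSubst (bsβ j)) (ψβ j) o)) (β≤V j)))
    slot-value : ∀ k → Eval M (cellEnv M E x) (var (suc (V + slot c (k % A)))) (E (V + slot c (k % A)))
    slot-value k = sym (readEnv-< M X (s≤s (V+s<m (slot<S (FinP.toℕ<n j) (DivMod.m%n<n k A)))))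
    go : ∀ k → Holds M B E (roleβ j k) (V + slot c (k % A)) → fvbT (σβ j k) ≤ suc V →
         Eval M (cellEnv M E x) (τβ j k) (valβ M B j (+ x) k)
    go zero holds fvb≤ with bsβ j zero
    ... | inj₁ e = sym (readEnv-< M X (s≤s z≤n))
    ... | inj₂ (a , zero , e) = sym (readEnv-H+ M X a)
    ... | inj₂ (a , suc y , e) with y <? V
    ...   | yes _  = trans (sym holds) (slot-value zero)
    ...   | no y≮V = ⊥-elim (y≮V (ℕP.≤-pred (subst (λ t → fvbT t ≤ suc V) e fvb≤)))
    go (suc i) holds fvb≤ with bsβ j (suc i)
    ... | inj₁ e with i <? V
    ...   | yes _  = trans (sym holds) (slot-value (suc i))
    ...   | no i≮V = ⊥-elim (i≮V (ℕP.≤-pred (subst (λ t → fvbT t ≤ suc V) e fvb≤)))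
    go (suc i) holds fvb≤ | inj₂ (a , zero , e) = sym (readEnv-H+ M X a)
    go (suc i) holds fvb≤ | inj₂ (a , suc y , e) with y <? V
    ...   | yes _  = trans (sym holds) (slot-value (suc i))
    ...   | no y≮V = ⊥-elim (y≮V (ℕP.≤-pred (subst (λ t → fvbT t ≤ suc V) e fvb≤)))

  Sat-α : ∀ M B E → Consistent M B E → Sat M B α ⇔ Sat M E (subF τα ψα)
  Sat-α M B E cons =
    ⇔.trans (Sat-subF M ψα (BasicSubst⇒ReadSubst bsα) (λ k _ → σα-denotes M B k) arα)
            (⇔.sym (Sat-subF M ψα (λ i → inj₁ (_ , refl)) (τα-denotes M B E cons) arα))

  Sat-β : ∀ M B E → Consistent M B E → ∀ j x →
          Sat M ((+ x) ∷ᵉ B) (β j) ⇔ Sat M (cellEnv M E x) (subF (τβ j) (ψβ j))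
  Sat-β M B E cons j x =
    ⇔.trans (Sat-subF M (ψβ j) (BasicSubst⇒ReadSubst (bsβ j)) (λ k _ → σβ-denotes M B j (+ x) k) (arβ j))
            (⇔.sym (Sat-subF M (ψβ j) (λ i → inj₁ (τβ-var j i)) (τβ-denotes M B E cons j x) (arβ j)))

  Γ-↑ˡ : ∀ j → Γ (j ↑ˡ S) ≡ subF (τβ j) (ψβ j)
  Γ-↑ˡ j rewrite FinP.splitAt-↑ˡ K j S = refl

  Γ-↑ʳ : ∀ s → Γ (K ↑ʳ s) ≡ slotCheck (slotRole (toℕ s)) (toℕ s)
  Γ-↑ʳ s rewrite FinP.splitAt-↑ʳ K S s = refl

  inΓ : Str → Env → Fin L → ℕ → Bool
  inΓ M F l x = isYes (em {Sat M (cellEnv M F x) (Γ l)})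

  Sat-Γ : ∀ M F l x → Sat M (cellEnv M F x) (Γ l) ⇔ T (inΓ M F l x)
  Sat-Γ M F l x with em {Sat M (cellEnv M F x) (Γ l)}
  ... | yes s = mk⇔ (λ _ → tt) (λ _ → s)
  ... | no ¬s = mk⇔ ¬s (λ ())

  size : Str → ℕ
  size M = clamp (Str.N M)

  cellCount : Str → Env → Fin K' → ℕ
  cellCount M F b = countBelow (cellᵇ L (inΓ M F) b) (size M)

  sumCellsIn-cellCount : ∀ M F l → sumCellsIn L l (cellCount M F) ≡ countBelow (inΓ M F l) (size M)
  sumCellsIn-cellCount M F = sumCellsIn-count (size M) L (inΓ M F) (λ _ → true)

  Eval-card-β' : ∀ M F F' → (∀ {i} → i < m → F i ≡ F' i) → ∀ b v →
                 Eval M F (card (β' b)) v ⇔ (v ≡ + cellCount M F' b)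
  Eval-card-β' M F F' agree b =
    Eval-card M F (β' b) (cellᵇ L (inΓ M F') b) λ i _ →
      ⇔.trans (Sat-β' M ((+ i) ∷ᵉ F) b)
     (⇔.trans (Sat-cong M (readEnv-agree M (+ i) agree) (cell L Γ b))
              (Sat-cell M (cellEnv M F' i) L Γ (inΓ M F') i (λ l → Sat-Γ M F' l i) b))

  Eval-card-β : ∀ M B E → Consistent M B E → ∀ j v →
                Eval M B (card (β j)) v ⇔ (v ≡ + countBelow (inΓ M E (j ↑ˡ S)) (size M))
  Eval-card-β M B E cons j =
    Eval-card M B (β j) (inΓ M E (j ↑ˡ S)) λ i _ →
      ⇔.trans (Sat-β M B E cons j i)
              (subst (λ φ → Sat M (cellEnv M E i) φ ⇔ T (inΓ M E (j ↑ˡ S) i)) (Γ-↑ˡ j)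
                     (Sat-Γ M E (j ↑ˡ S) i))

  Sat-slotCheck : ∀ M F x a w w<V {s} → s < S →
    Sat M (cellEnv M F x) (slotCheck (oldRead a w w<V) s) ⇔ ((+ x ≡ F w) × Str.arr M a (+ x) ≢ F (V + s))
  Sat-slotCheck M F x a w w<V {s} s<S = mk⇔
    (λ (x≡w , ¬a≡s) → trans (sym X0) (trans (to (Sat-eq-var M X 0 (suc w)) x≡w) Xw) ,
                      λ a≡s → ¬a≡s (from (Sat-eq-var M X (H + a) (suc (V + s))) (trans Xa (trans a≡s (sym Xs)))))
    (λ (x≡w , a≢s) → from (Sat-eq-var M X 0 (suc w)) (trans X0 (trans x≡w (sym Xw))) ,
                     λ a≡s → a≢s (trans (sym Xa) (trans (to (Sat-eq-var M X (H + a) (suc (V + s))) a≡s) Xs)))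
    where
    X : Env
    X = cellEnv M F x
    X0 : X 0 ≡ + x
    X0 = readEnv-< M ((+ x) ∷ᵉ F) (s≤s z≤n)
    Xw : X (suc w) ≡ F w
    Xw = readEnv-< M ((+ x) ∷ᵉ F) (s≤s (ℕP.≤-trans w<V (ℕP.m≤m+n V S)))
    Xa : X (H + a) ≡ Str.arr M a (+ x)
    Xa = readEnv-H+ M ((+ x) ∷ᵉ F) a
    Xs : X (suc (V + s)) ≡ F (V + s)
    Xs = readEnv-< M ((+ x) ∷ᵉ F) (s≤s (V+s<m s<S))

  Sat-inRangeOrZero⁺ : ∀ M F w s a → F s ≡ Str.arr M a (F w) → Sat M F (inRangeOrZero w s)
  Sat-inRangeOrZero⁺ M F w s a s≡a[w] (¬inRange , s≢0) with F w ℤP.<? + 0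
  ... | yes w<0 = s≢0 (F s , + 0 , refl , refl , trans s≡a[w] (Str.arr-out M a (F w) (inj₁ w<0)))
  ... | no w≮0 with F w ℤP.<? Str.N M
  ...   | yes w<N =
    ¬inRange ((λ { (_ , _ , refl , refl , w<0) → w≮0 w<0 }) , (F w , Str.N M , refl , refl , w<N))
  ...   | no w≮N =
    s≢0 (F s , + 0 , refl , refl , trans s≡a[w] (Str.arr-out M a (F w) (inj₂ (ℤP.≮⇒≥ w≮N))))

  Sat-inRangeOrZero⁻ : ∀ M F w s → Sat M F (inRangeOrZero w s) →
                       ¬ (+ 0 ℤ.≤ F w × F w ℤ.< Str.N M) → F s ≡ + 0
  Sat-inRangeOrZero⁻ M F w s sat ¬inRange with em {F s ≡ + 0}
  ... | yes s≡0 = s≡0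
  ... | no s≢0  = ⊥-elim (sat (¬sat-inRange , λ { (_ , _ , refl , refl , s≡0) → s≢0 s≡0 }))
    where
    ¬sat-inRange : ¬ Sat M F (not (lt (var w) (num (+ 0))) ∧' lt (var w) Npar)
    ¬sat-inRange (¬w<0 , (u , v , refl , refl , w<N)) =
      ¬inRange (ℤP.≮⇒≥ (λ w<0 → ¬w<0 (F w , + 0 , refl , refl , w<0)) , w<N)

  Consistent-agree : ∀ {M B E E'} → Consistent M B E → (∀ {i} → i < m → E' i ≡ E i) → Consistent M B E'
  Consistent-agree {M} {B} {E} {E'} (olds , holds) agree =
    (λ i<V → trans (agree (ℕP.≤-trans i<V (ℕP.m≤m+n V S))) (olds i<V)) ,
    (λ {s} s<S → transport (slotRole s) (agree (V+s<m s<S)) (holds s<S))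
    where
    transport : ∀ r {p} → E' p ≡ E p → Holds M B E r p → Holds M B E' r p
    transport (old _ _)       E'p≡Ep h = trans E'p≡Ep h
    transport (oldRead _ _ _) E'p≡Ep h = trans E'p≡Ep h
    transport bound           E'p≡Ep h = h
    transport (boundRead _)   E'p≡Ep h = h
    transport unused          E'p≡Ep h = h

  W : ℕ
  W = K' + m

  -- The cell sizes are computed in Eˢ, which agrees with E below m: E itself contains them.
  module Witness (M : Str) (ρ : Env) (e : ℕ → ℤ) where
    B : Env
    B = prepend V e ρ

    roleValue : Role → ℤ
    roleValue (old w _)       = B w
    roleValue (oldRead a w _) = Str.arr M a (B w)
    roleValue _               = + 0

    eˢ : ℕ → ℤ
    eˢ = prepend V e (λ s → roleValue (slotRole s))

    Eˢ : Env
    Eˢ = prepend m eˢ ρ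

    cellCountAt : ℕ → ℤ
    cellCountAt k with k <? K'
    ... | yes k<K' = + cellCount M Eˢ (fromℕ< k<K')
    ... | no _     = + 0

    e' : ℕ → ℤ
    e' = prepend m eˢ cellCountAt

    E : Env
    E = prepend W e' ρ

    E≡eˢ : ∀ {i} → i < m → E i ≡ eˢ i
    E≡eˢ i<m = trans (prepend-< W e' ρ (ℕP.≤-trans i<m (ℕP.m≤n+m m K'))) (prepend-< m eˢ _ i<m)

    Eˢ≡E : ∀ {i} → i < m → Eˢ i ≡ E i
    Eˢ≡E i<m = trans (prepend-< m eˢ ρ i<m) (sym (E≡eˢ i<m))

    E-cellSize : ∀ b → E (m + toℕ b) ≡ + cellCount M Eˢ b
    E-cellSize b = begin
      E (m + toℕ b)                ≡⟨ prepend-< W e' ρ m+b<W ⟩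
      e' (m + toℕ b)               ≡⟨ prepend-≮ m eˢ cellCountAt (ℕP.≤⇒≯ (ℕP.m≤m+n m (toℕ b))) ⟩
      cellCountAt (m + toℕ b ∸ m)  ≡⟨ cong cellCountAt (ℕP.m+n∸m≡n m (toℕ b)) ⟩
      cellCountAt (toℕ b)          ≡⟨ cellCountAt-toℕ ⟩
      + cellCount M Eˢ b           ∎
      where
      open ≡-Reasoning
      m+b<W : m + toℕ b < W
      m+b<W = subst (m + toℕ b <_) (ℕP.+-comm m K') (ℕP.+-monoʳ-< m (FinP.toℕ<n b))
      cellCountAt-toℕ : cellCountAt (toℕ b) ≡ + cellCount M Eˢ b
      cellCountAt-toℕ with toℕ b <? K'
      ... | yes b<K' = cong (λ b' → + cellCount M Eˢ b') (FinP.fromℕ<-toℕ b b<K')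
      ... | no b≮K'  = ⊥-elim (b≮K' (FinP.toℕ<n b))

    Consistent-E : Consistent M B E
    Consistent-E = (λ i<V → trans (E≡eˢ (ℕP.≤-trans i<V (ℕP.m≤m+n V S)))
                                       (trans (prepend-< V e _ i<V) (sym (prepend-< V e ρ i<V))))
                 , (λ {s} s<S → holds (slotRole s) (trans (E≡eˢ (V+s<m s<S)) (eˢ-slot s)))
      where
      eˢ-slot : ∀ s → eˢ (V + s) ≡ roleValue (slotRole s)
      eˢ-slot s = trans (prepend-≮ V e _ (ℕP.≤⇒≯ (ℕP.m≤m+n V s)))
                        (cong (λ s' → roleValue (slotRole s')) (ℕP.m+n∸m≡n V s))
      holds : ∀ r {p} → E p ≡ roleValue r → Holds M B E r p
      holds (old _ _)       Ep≡ = Ep≡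
      holds (oldRead _ _ _) Ep≡ = Ep≡
      holds bound           Ep≡ = tt
      holds (boundRead _)   Ep≡ = tt
      holds unused          Ep≡ = tt

    Consistent-Eˢ : Consistent M B Eˢ
    Consistent-Eˢ = Consistent-agree Consistent-E Eˢ≡E

  module WitnessSat (M : Str) (ρ : Env) (e : ℕ → ℤ) where
    open Witness M ρ e

    cellSize-denotes : ∀ b → Denotes M E (cellSize b) (cellCount M Eˢ b)
    cellSize-denotes b = Denotes-var M E (E-cellSize b)

    Sat-slotEquation : ∀ s → Sat M E (slotEquationAt s)
    Sat-slotEquation s = go (slotRole (toℕ s)) refl
      where
      holds : ∀ {r} F → r ≡ slotRole (toℕ s) → Consistent M B F → Holds M B F r (V + toℕ s)
      holds F r≡ cons = subst (λ r → Holds M B F r (V + toℕ s)) (sym r≡) (proj₂ cons (FinP.toℕ<n s))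

      go : ∀ r → r ≡ slotRole (toℕ s) → Sat M E (slotEquation r s)
      go (old w w<V) r≡ =
        from (Sat-eq-var M E (V + toℕ s) w) (trans (holds E r≡ Consistent-E) (sym (proj₁ Consistent-E w<V)))
      go (oldRead a w w<V) r≡ =
        (_ , _ , from (Eval-sumCellsInT M E L (K ↑ʳ s) cellSize-denotes _) refl , refl ,
          cong +_ (trans (sumCellsIn-cellCount M Eˢ (K ↑ʳ s))
                         (countBelow-false _ (size M) (λ {x} _ → to BoolP.T-not-≡ (to ¬T⇔T-not (∉slotCheck x)))))) ,
        Sat-inRangeOrZero⁺ M E w (V + toℕ s) a
          (trans (holds E r≡ Consistent-E) (cong (Str.arr M a) (sym (proj₁ Consistent-E w<V))))
        where
        ∉slotCheck : ∀ x → ¬ T (inΓ M Eˢ (K ↑ʳ s) x)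
        ∉slotCheck x x∈
          with to (Sat-slotCheck M Eˢ x a w w<V (FinP.toℕ<n s))
                  (subst (λ r → Sat M (cellEnv M Eˢ x) (slotCheck r (toℕ s))) (sym r≡)
                    (subst (Sat M (cellEnv M Eˢ x)) (Γ-↑ʳ s) (from (Sat-Γ M Eˢ (K ↑ʳ s) x) x∈)))
        ... | x≡w , a[x]≢slot = a[x]≢slot
          (trans (cong (Str.arr M a) (trans x≡w (proj₁ Consistent-Eˢ w<V))) (sym (holds Eˢ r≡ Consistent-Eˢ)))
      go bound         r≡ = Sat-tt' M E
      go (boundRead _) r≡ = Sat-tt' M E
      go unused        r≡ = Sat-tt' M E

    Sat-cardEquation : ∀ b → Sat M E (eq (card (β' b)) (var (m + toℕ b)))
    Sat-cardEquation b = + cellCount M Eˢ b , E (m + toℕ b) ,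
      from (Eval-card-β' M E Eˢ (λ i<m → sym (Eˢ≡E i<m)) b _) refl , refl , sym (E-cellSize b)

  body→body' : ∀ M ρ e → Sat M (prepend V e ρ) body → Sat M (Witness.E M ρ e) body'
  body→body' M ρ e (sα , scards) =
    (to (Sat-α M B E Consistent-E) sα , Sat-⋀⁺ M E K countEquation countEq , Sat-⋀⁺ M E S _ Sat-slotEquation) ,
    Sat-⋀⁺ M E K' _ Sat-cardEquation
    where
    open Witness M ρ e
    open WitnessSat M ρ e

    B-count : ∀ j → B (toℕ j) ≡ + countBelow (inΓ M Eˢ (j ↑ˡ S)) (size M)
    B-count j with Sat-⋀⁻ M B K _ scards j
    ... | u , w , ec , w≡ , u≡w =
      trans (sym w≡) (trans (sym u≡w) (to (Eval-card-β M B Eˢ Consistent-Eˢ j u) ec))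

    countEq : ∀ j → Sat M E (countEquation j)
    countEq j = E (toℕ j) , _ , refl , from (Eval-sumCellsInT M E L (j ↑ˡ S) cellSize-denotes _) refl ,
      trans (proj₁ Consistent-E (ℕP.≤-trans (FinP.toℕ<n j) (ℕP.m≤n+m K _)))
            (trans (B-count j) (cong +_ (sym (sumCellsIn-cellCount M Eˢ (j ↑ˡ S)))))

  module Readback (M : Str) (ρ : Env) (e' : ℕ → ℤ) where
    E B : Env
    E = prepend W e' ρ
    B = prepend V e' ρ

    E≡B : ∀ {i} → i < V → E i ≡ B i
    E≡B i<V = trans (prepend-< W e' ρ (ℕP.≤-trans i<V (ℕP.≤-trans (ℕP.m≤m+n V S) (ℕP.m≤n+m m K'))))
                    (sym (prepend-< V e' ρ i<V))

    module _ (E-cellSize : ∀ b → E (m + toℕ b) ≡ + cellCount M E b) where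
      cellSize-denotes : ∀ b → Denotes M E (cellSize b) (cellCount M E b)
      cellSize-denotes b = Denotes-var M E (E-cellSize b)

      slotEquation⇒Holds : ∀ s r → r ≡ slotRole (toℕ s) → Sat M E (slotEquation r s) → Holds M B E r (V + toℕ s)
      slotEquation⇒Holds s (old w w<V) r≡ sat = trans (to (Sat-eq-var M E (V + toℕ s) w) sat) (E≡B w<V)
      slotEquation⇒Holds s (oldRead a w w<V) r≡ ((u , z , eu , z≡0 , u≡z) , inRangeOrZero)
        with em {+ 0 ℤ.≤ E w × E w ℤ.< Str.N M}
      ... | yes (0≤Ew , Ew<N) = inRange (E w) refl 0≤Ew Ew<N
        where
        no-x : countBelow (inΓ M E (K ↑ʳ s)) (size M) ≡ 0
        no-x = trans (sym (sumCellsIn-cellCount M E (K ↑ʳ s))) (ℤP.+-injective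
          (trans (sym (to (Eval-sumCellsInT M E L (K ↑ʳ s) cellSize-denotes u) eu)) (trans u≡z z≡0)))
        inRange : ∀ z → z ≡ E w → + 0 ℤ.≤ z → z ℤ.< Str.N M → E (V + toℕ s) ≡ Str.arr M a (B w)
        inRange (+ x) x≡w _ x<N with Str.arr M a (+ x) ℤP.≟ E (V + toℕ s)
        ... | yes a[x]≡s = trans (sym a[x]≡s) (cong (Str.arr M a) (trans x≡w (E≡B w<V)))
        ... | no a[x]≢s  = ⊥-elim (subst T (countBelow≡0⇒false _ (size M) no-x (+<⇒<clamp (Str.N M) x<N))
          (to (Sat-Γ M E (K ↑ʳ s) x) (subst (Sat M (cellEnv M E x)) (sym (Γ-↑ʳ s))
            (subst (λ r → Sat M (cellEnv M E x) (slotCheck r (toℕ s))) r≡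
              (from (Sat-slotCheck M E x a w w<V (FinP.toℕ<n s)) (x≡w , a[x]≢s))))))
      ... | no ¬inRange = trans (Sat-inRangeOrZero⁻ M E w (V + toℕ s) inRangeOrZero ¬inRange)
                                (sym (Str.arr-out M a (B w) outside))
        where
        outside : B w ℤ.< + 0 ⊎ Str.N M ℤ.≤ B w
        outside with E w ℤP.<? + 0
        ... | yes Ew<0 = inj₁ (subst (ℤ._< + 0) (E≡B w<V) Ew<0)
        ... | no Ew≮0  =
          inj₂ (subst (Str.N M ℤ.≤_) (E≡B w<V) (ℤP.≮⇒≥ λ Ew<N → ¬inRange (ℤP.≮⇒≥ Ew≮0 , Ew<N)))
      slotEquation⇒Holds s bound         r≡ sat = tt
      slotEquation⇒Holds s (boundRead _) r≡ sat = tt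
      slotEquation⇒Holds s unused        r≡ sat = tt

  body'→body : ∀ M ρ e' → Sat M (prepend W e' ρ) body' → Sat M (prepend V e' ρ) body
  body'→body M ρ e' ((sα' , scounts , sslots) , scards) =
    from (Sat-α M B E consistent) sα' , Sat-⋀⁺ M B K _ cardEq
    where
    open Readback M ρ e'

    E-cellSize : ∀ b → E (m + toℕ b) ≡ + cellCount M E b
    E-cellSize b with Sat-⋀⁻ M E K' _ scards b
    ... | u , w , ec , w≡ , u≡w =
      trans (sym w≡) (trans (sym u≡w) (to (Eval-card-β' M E E (λ _ → refl) b u) ec))

    consistent : Consistent M B E
    consistent = E≡B , λ s<S →
      subst (λ s → Holds M B E (slotRole s) (V + s)) (FinP.toℕ-fromℕ< s<S)
            (slotEquation⇒Holds E-cellSize (fromℕ< s<S) _ refl (Sat-⋀⁻ M E S slotEquationAt sslots (fromℕ< s<S)))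

    cardEq : ∀ j → Sat M B (eq (card (β j)) (var (toℕ j)))
    cardEq j with Sat-⋀⁻ M E K countEquation scounts j
    ... | u , w , Ej≡u , Eval-sum , u≡w =
      + countBelow (inΓ M E (j ↑ˡ S)) (size M) , B (toℕ j) ,
      from (Eval-card-β M B E consistent j _) refl , refl ,
      sym (trans (sym (E≡B (ℕP.≤-trans (FinP.toℕ<n j) (ℕP.m≤n+m K _))))
          (trans (sym Ej≡u) (trans u≡w
            (trans (to (Eval-sumCellsInT M E L (j ↑ˡ S) (cellSize-denotes E-cellSize) w) Eval-sum)
                   (cong +_ (sumCellsIn-cellCount M E (j ↑ˡ S)))))))

  closure-equiv : Equiv (closure (exN K body)) θ
  closure-equiv M ρ = mk⇔ forward backward
    where
    forward : Sat M ρ (exN (fvb (exN K body)) (exN K body)) → Sat M ρ θ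
    forward s with to (Sat-exN M ρ V body) (subst (Sat M ρ) (sym (exN-+ _ K body)) s)
    ... | e , sb = subst (Sat M ρ) (exN-+ K' m body')
                         (from (Sat-exN M ρ W body') (Witness.e' M ρ e , body→body' M ρ e sb))

    backward : Sat M ρ θ → Sat M ρ (exN (fvb (exN K body)) (exN K body))
    backward s with to (Sat-exN M ρ W body') (subst (Sat M ρ) (sym (exN-+ K' m body')) s)
    ... | e' , sb = subst (Sat M ρ) (exN-+ _ K body) (from (Sat-exN M ρ V body) (e' , body'→body M ρ e' sb))

  partitionForm : PartitionForm θ
  partitionForm = K' , m , α' , β' , Arith-α' , BasicX-β' , partition , refl , fvb-θ

lemma1 : ExcludedMiddle 0ℓ → (φ : Form) → EFlat φ →
    Σ Form (λ θ → PartitionForm θ × Equiv (closure φ) θ)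
lemma1 em φ (K , α , β , (ψα , arα , σα , bsα , refl) , basicβ , φ≡) =
  θ , partitionForm , subst (λ φ' → Equiv (closure φ') θ) (sym φ≡body) closure-equiv
  where
  ψβ : Fin K → Form
  ψβ j = proj₁ (basicβ j)
  σβ : Fin K → ℕ → Term
  σβ j = proj₁ (proj₂ (proj₂ (basicβ j)))
  β≡ : ∀ j → β j ≡ subF (σβ j) (ψβ j)
  β≡ j = proj₂ (proj₂ (proj₂ (proj₂ (basicβ j))))

  open FlatToPartition em K ψα arα σα bsα ψβ (λ j → proj₁ (proj₂ (basicβ j)))
                       σβ (λ j → proj₁ (proj₂ (proj₂ (proj₂ (basicβ j)))))

  φ≡body : φ ≡ exN K body
  φ≡body = trans φ≡ (cong (λ cards → exN K (subF σα ψα ∧' cards))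
                          (⋀-cong K (λ j → cong (λ b → eq (card b) (var (toℕ j))) (β≡ j))))
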